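{- Let $T$ be a primed tableau and $i\ge1$, $j=i+1$. If $f_i(T)\neq0$ then, with $x,q$ the positions chosen in the definition of $f_i$, either $q=x$, in which case $f_i(T)$ is obtained from $T$ by changing the $i$ in $x$ into $j$, or else $f_i(T)$ is obtained by changing the $i$ in $x$ into $j'$ and the $j'$ in $q$ into $j$. Moreover, $f_i(T)$ is a primed tableau.
   Context: Entries are ordered $1'<1<2'<2<3'<3<\cdots$; increasing an entry "by a half unit" means replacing it by the next entry in this order ($i'\mapsto i$, $i\mapsto (i+1)'$). A primed tableau of shape $\lambda/\mu$ is a filling of the skew Young diagram (English convention) with such entries, rows and columns weakly increasing, each row containing at most one $i'$ for each $i$, and each column at most one unprimed $i$ for each $i$. For a position $p$, $c(p)$ is its entry, with $c(p)=\infty$ if $p$ is not a box of $T$. The reading word of $T$ consists of the unprimed entries read along rows left to right, from the bottom row to the top row; the $i$-$j$ subword keeps only letters $i,j$; bracketing pairs a $j$ with an $i$ to its right with all letters in between already paired ($j$ = opening, $i$ = closing parenthesis), repeatedly; unpaired letters are unbracketed. Operator $f_i$: if the $i$-$j$ subword has no unbracketed $i$, $f_i(T)=0$. Otherwise let $x$ be the position of the rightmost unbracketed $i$, $E_x$ the position immediately right of $x$, $S_x$ the position immediately below. Choose $q$: (F1) if $c(E_x)\ge j$ and $c(S_x)>j$, $q=x$; (F2) if $c(E_x)=j'$, $q=E_x$; (F3) if $c(E_x)\ge j$ and $c(S_x)\in\{j',j\}$, $q$ is the Southwest-most position of the maximal ribbon (connected skew shape with no $2\times2$ square) starting at $S_x$,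 extending South and/or West, containing only entries $j$ and $j'$. Then $f_i(T)$ is obtained by increasing $c(x)$ by a half unit and then $c(q)$ by a half unit (so if $q=x$ the entry of $x$ increases by a full unit). -}

module Defs where

open import Data.Nat using (ℕ; zero; suc; _+_; _*_; _∸_; _≤_; _<_; _≤ᵇ_; _<ᵇ_; _≡ᵇ_)
open import Data.Bool using (Bool; true; false; if_then_else_; _∧_; _∨_)
open import Data.List using (List; []; _∷_; length; reverse; concat; last)
open import Data.Maybe using (Maybe; just; nothing; _>>=_)
open import Data.Product using (Σ; _×_; _,_; ∃)
open import Data.Unit using (⊤)
open import Data.Empty using (⊥)
open import Relation.Binary.PropositionalEquality using (_≡_)

-- The totally ordered alphabet 1' < 1 < 2' < 2 < ... is encoded
-- by positive natural numbers:  i' ↦ 2i-1,  i ↦ 2i.  The order of the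
-- alphabet is then the order of ℕ, and "increase by a half unit" is suc.

prim : ℕ → ℕ
prim i = 2 * i ∸ 1

unp : ℕ → ℕ
unp i = 2 * i

-- Positions (row , column), 0-indexed, English convention
-- (row index grows going South, column index grows going East).

Pos : Set
Pos = ℕ × ℕ

-- A filling of a skew diagram λ/μ: row r is given as (μ_r , entries of row r),
-- so row r occupies the columns μ_r , … , μ_r + length − 1, i.e. λ_r = μ_r + length.
record Tableau : Set where
  constructor mkT
  field
    rows : List (ℕ × List ℕ)
open Tableau public

nth : {A : Set} → List A → ℕ → Maybe A
nth []       _       = nothing
nth (a ∷ _)  zero    = just a
nth (_ ∷ as) (suc n) = nth as n

-- c(p): nothing plays the role of ∞ (p not a box of T).
entry : Tableau → Pos → Maybe ℕ
entry T (r , c) with nth (rows T) r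
... | nothing = nothing
... | just (o , es) = if c <ᵇ o then nothing else nth es (c ∸ o)

-- λ and μ are partitions: μ_r and λ_r = μ_r + length(row r) weakly decrease.
ShapeOK : List (ℕ × List ℕ) → Set
ShapeOK [] = ⊤
ShapeOK (_ ∷ []) = ⊤
ShapeOK ((o₁ , e₁) ∷ (o₂ , e₂) ∷ rs) =
  o₂ ≤ o₁ × (o₂ + length e₂ ≤ o₁ + length e₁) × ShapeOK ((o₂ , e₂) ∷ rs)

record IsPrimedTableau (T : Tableau) : Set where
  field
    shape     : ShapeOK (rows T)
    entriesOK : ∀ p v → entry T p ≡ just v → 1 ≤ v
    rowWeak   : ∀ r c u v → entry T (r , c) ≡ just u → entry T (r , suc c) ≡ just v → u ≤ v
    colWeak   : ∀ r c u v → entry T (r , c) ≡ just u → entry T (suc r , c) ≡ just v → u ≤ v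
    rowPrime  : ∀ r c₁ c₂ i → c₁ < c₂ →
                entry T (r , c₁) ≡ just (prim i) → entry T (r , c₂) ≡ just (prim i) → ⊥
    colUnp    : ∀ r₁ r₂ c i → r₁ < r₂ →
                entry T (r₁ , c) ≡ just (unp i) → entry T (r₂ , c) ≡ just (unp i) → ⊥

-- Reading word: cells of each row left to right, rows from bottom to top;
-- only unprimed entries are kept (letter = the i of the entry i).

rowCells : ℕ → ℕ → List ℕ → List (Pos × ℕ)
rowCells r c []       = []
rowCells r c (e ∷ es) = ((r , c) , e) ∷ rowCells r (suc c) es

indexedRows : ℕ → List (ℕ × List ℕ) → List (List (Pos × ℕ))
indexedRows r []              = []
indexedRows r ((o , es) ∷ rs) = rowCells r o es ∷ indexedRows (suc r) rs

keepCodes : (ℕ → Bool) → List (Pos × ℕ) → List (Pos × ℕ)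
keepCodes P [] = []
keepCodes P ((p , e) ∷ w) = if P e then (p , e) ∷ keepCodes P w else keepCodes P w

ijSubword : ℕ → ℕ → Tableau → List (Pos × ℕ)
ijSubword i j T =
  keepCodes (λ e → (e ≡ᵇ unp i) ∨ (e ≡ᵇ unp j))
            (concat (reverse (indexedRows 0 (rows T))))

-- Bracketing: scanning left to right, each j is an opening parenthesis and
-- each i a closing one; an i is bracketed iff it closes a pending j.
-- (k = number of currently unmatched j's.)  Returns the unbracketed i's.
unbracketedI : ℕ → ℕ → ℕ → List (Pos × ℕ) → List Pos
unbracketedI i j k [] = []
unbracketedI i j k ((p , e) ∷ w) =
  if e ≡ᵇ unp j then unbracketedI i j (suc k) w
  else (if e ≡ᵇ unp i then step k else unbracketedI i j k w)
  where
  step : ℕ → List Pos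
  step zero    = p ∷ unbracketedI i j zero w
  step (suc k) = unbracketedI i j k w

rightmostUnbracketed : ℕ → Tableau → Maybe Pos
rightmostUnbracketed i T = last (unbracketedI i (suc i) 0 (ijSubword i (suc i) T))

geqE : Maybe ℕ → ℕ → Bool
geqE nothing  n = true
geqE (just v) n = n ≤ᵇ v

gtE : Maybe ℕ → ℕ → Bool
gtE nothing  n = true
gtE (just v) n = n <ᵇ v

eqE : Maybe ℕ → ℕ → Bool
eqE nothing  n = false
eqE (just v) n = v ≡ᵇ n

inJ : ℕ → Tableau → Pos → Bool
inJ j T p = eqE (entry T p) (prim j) ∨ eqE (entry T p) (unp j)

-- Walk along the maximal ribbon of entries j', j starting at p and extending
-- South and/or West; returns its Southwest-most position.  (At each step
-- the next box of the ribbon is the one South, else the one West.)  The fuel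
-- bounds the number of possible South plus West steps.
walk : ℕ → ℕ → Tableau → Pos → Pos
walk zero    j T p = p
walk (suc n) j T (r , c) =
  if inJ j T (suc r , c) then walk n j T (suc r , c) else west c
  where
  west : ℕ → Pos
  west zero     = (r , zero)
  west (suc c′) = if inJ j T (r , c′) then walk n j T (r , c′) else (r , suc c′)

-- The choice of q (cases F1, F2, F3), given x; nothing if no case applies.
chooseQ : ℕ → Tableau → Pos → Maybe Pos
chooseQ i T (r , c) =
  if geqE cE (unp j) ∧ gtE cS (unp j) then just (r , c)
  else if eqE cE (prim j) then just (r , suc c)
  else if geqE cE (unp j) ∧ (eqE cS (prim j) ∨ eqE cS (unp j))
       then just (walk (length (rows T) + c) j T (suc r , c))
  else nothing
  where
  j  = suc i
  cE = entry T (r , suc c)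
  cS = entry T (suc r , c)

updAt : (ℕ → ℕ) → ℕ → List ℕ → List ℕ
updAt g _       []       = []
updAt g zero    (e ∷ es) = g e ∷ es
updAt g (suc n) (e ∷ es) = e ∷ updAt g n es

updRows : (ℕ → ℕ) → ℕ → ℕ → List (ℕ × List ℕ) → List (ℕ × List ℕ)
updRows g _       c []              = []
updRows g zero    c ((o , es) ∷ rs) =
  (if c <ᵇ o then (o , es) else (o , updAt g (c ∸ o) es)) ∷ rs
updRows g (suc r) c (row ∷ rs)      = row ∷ updRows g r c rs

modifyEntry : (ℕ → ℕ) → Pos → Tableau → Tableau
modifyEntry g (r , c) T = mkT (updRows g r c (rows T))

setEntry : Pos → ℕ → Tableau → Tableau
setEntry p v = modifyEntry (λ _ → v) p

halfUp : Pos → Tableau → Tableau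
halfUp = modifyEntry suc

-- The operator f_i (nothing = 0).

f : ℕ → Tableau → Maybe Tableau
f i T =
  rightmostUnbracketed i T >>= λ x →
  chooseQ i T x >>= λ q →
  just (halfUp q (halfUp x T))

module Submission where

-- As x is unbracketed, from any
-- box y up to x at least as many i's as j's are read ('bracket').  An
-- invariant comparing these counts along the ribbon of entries j', j below x
-- ('Excess') gives three local facts: the box East of x is not an i, the box
-- Southeast of x is not a j, and the walk of case F3 stops at a j' below
-- row r.  These supply the fitting conditions in the cases F1, F2, F3, and
-- unfolding the definition of f_i gives the description of f_i(T).

open import Defs
open import Data.Nat using (ℕ; zero; suc; pred; _+_; _∸_; _≤_; _<_; _≤ᵇ_; _<ᵇ_; _≡ᵇ_;
  z≤n; s≤s; _≟_; _<?_; _≤?_)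
open import Data.Nat.Properties
open import Data.Bool using (true; false; if_then_else_; _∧_; _∨_) renaming (T to Tb)
open import Data.Bool.Properties using (∨-zeroʳ)
open import Data.List using (List; []; _∷_; _++_; length; reverse; concat; last; map)
open import Data.List.Properties using (++-assoc; unfold-reverse; concat-++; ++-identityʳ;
  ∷-injectiveˡ; ∷-injectiveʳ)
open import Data.List.Relation.Unary.All as All using (All; []; _∷_)
open import Data.List.Relation.Unary.All.Properties using (++⁺; ++⁻ˡ; ++⁻ʳ; concat⁺)
open import Data.List.Relation.Unary.Any as Any using (Any; here; there)
open import Data.List.Relation.Unary.Any.Properties using (reverse⁺; reverse⁻)
open import Data.List.Relation.Unary.AllPairs using (AllPairs; []; _∷_)
open import Data.List.Relation.Unary.AllPairs.Properties as AllPairs using ()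
open import Data.List.Membership.Propositional using (_∈_)
open import Data.List.Membership.Propositional.Properties using (∈-concat⁺′; ∈-∃++; ∈-++⁻)
open import Data.Maybe using (Maybe; just; nothing)
open import Data.Maybe.Properties using (just-injective)
open import Data.Product using (Σ; _×_; _,_; proj₁; proj₂)
open import Data.Product.Properties using (≡-dec)
open import Data.Sum using (_⊎_; inj₁; inj₂; [_,_]′)
open import Data.Empty using (⊥; ⊥-elim)
open import Function using (_∘_; id; case_of_)
open import Relation.Nullary using (¬_; Dec; yes; no; does)
open import Relation.Nullary.Decidable using (¬?; _×-dec_)
open import Relation.Binary.PropositionalEquality hiding (J)
open import Relation.Binary.Definitions using (tri<; tri≈; tri>)

T⇒true : ∀ {b} → Tb b → b ≡ true
T⇒true {true} _ = refl

true⇒T : ∀ {b} → b ≡ true → Tb b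
true⇒T refl = _

¬T⇒false : ∀ {b} → ¬ Tb b → b ≡ false
¬T⇒false {false} _ = refl
¬T⇒false {true} h = ⊥-elim (h _)

≡ᵇ-true : ∀ {m n} → m ≡ n → (m ≡ᵇ n) ≡ true
≡ᵇ-true {m} {n} h = T⇒true (≡⇒≡ᵇ m n h)

≡ᵇ-false : ∀ {m n} → m ≢ n → (m ≡ᵇ n) ≡ false
≡ᵇ-false {m} {n} h = ¬T⇒false (h ∘ ≡ᵇ⇒≡ m n)

<ᵇ-false : ∀ {m n} → n ≤ m → (m <ᵇ n) ≡ false
<ᵇ-false {m} {n} h = ¬T⇒false (λ t → <⇒≱ (<ᵇ⇒< m n t) h)

≤ᵇ-false : ∀ {m n} → n < m → (m ≤ᵇ n) ≡ false
≤ᵇ-false {m} {n} h = ¬T⇒false (λ t → <⇒≱ h (≤ᵇ⇒≤ m n t))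

unp-suc : ∀ i → unp (suc i) ≡ suc (suc (unp i))
unp-suc i = cong suc (+-suc i (i + 0))

prim-suc : ∀ i → prim (suc i) ≡ suc (unp i)
prim-suc i = +-suc i (i + 0)

unp-suc-≢ : ∀ i → unp (suc i) ≢ unp i
unp-suc-≢ i eq = <-irrefl (sym eq) (*-monoʳ-< 2 (n<1+n i))

odd≢unp : ∀ m k → suc (unp m) ≢ unp k
odd≢unp m zero ()
odd≢unp zero (suc k) q = case trans q (unp-suc k) of λ ()
odd≢unp (suc m) (suc k) q =
  odd≢unp m k (suc-injective (suc-injective (trans (cong suc (sym (unp-suc m))) (trans q (unp-suc k)))))

even≢prim : ∀ m k → suc (suc (unp m)) ≢ prim k
even≢prim m zero ()
even≢prim m (suc k) q = odd≢unp m k (suc-injective (trans q (prim-suc k)))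

≢⇒<⊎> : ∀ {m n} → m ≢ n → m < n ⊎ n < m
≢⇒<⊎> {m} {n} h with <-cmp m n
... | tri< m<n _ _ = inj₁ m<n
... | tri≈ _ m≡n _ = ⊥-elim (h m≡n)
... | tri> _ _ n<m = inj₂ n<m

-- Reading order: p ≺ q when p is read before q, i.e. p lies in a lower row,
-- or in the same row further West.

_≺_ : Pos → Pos → Set
(s , b) ≺ (s′ , b′) = s′ < s ⊎ (s ≡ s′ × b < b′)

≺-trans : ∀ {p q w} → p ≺ q → q ≺ w → p ≺ w
≺-trans (inj₁ x) (inj₁ y) = inj₁ (<-trans y x)
≺-trans (inj₁ x) (inj₂ (refl , _)) = inj₁ x
≺-trans (inj₂ (refl , _)) (inj₁ y) = inj₁ y
≺-trans (inj₂ (refl , x)) (inj₂ (refl , y)) = inj₂ (refl , <-trans x y)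

≺-irrefl : ∀ {p} → p ≺ p → ⊥
≺-irrefl (inj₁ x) = <-irrefl refl x
≺-irrefl (inj₂ (_ , x)) = <-irrefl refl x

≺-asym : ∀ {p q} → p ≺ q → q ≺ p → ⊥
≺-asym a b = ≺-irrefl (≺-trans a b)

_≺?_ : (p q : Pos) → Dec (p ≺ q)
(s , b) ≺? (s′ , b′) with s′ <? s
... | yes h = yes (inj₁ h)
... | no h with s ≟ s′ | b <? b′
... | yes e | yes l = yes (inj₂ (e , l))
... | yes e | no l = no λ { (inj₁ x) → h x ; (inj₂ (_ , x)) → l x }
... | no e | _ = no λ { (inj₁ x) → h x ; (inj₂ (x , _)) → e x }

_≟ₚ_ : (p q : Pos) → Dec (p ≡ q)
_≟ₚ_ = ≡-dec _≟_ _≟_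

≺-no-between : ∀ {r c p} → (r , c) ≺ p → p ≺ (r , suc c) → ⊥
≺-no-between (inj₁ l1) (inj₁ l2) = <-asym l1 l2
≺-no-between (inj₁ l1) (inj₂ (refl , _)) = <-irrefl refl l1
≺-no-between (inj₂ (refl , _)) (inj₁ l2) = <-irrefl refl l2
≺-no-between (inj₂ (_ , l1)) (inj₂ (_ , l2)) = <-irrefl refl (≤-trans l1 (≤-pred l2))

≺-west-neighbour : ∀ {s b p} → p ≺ (s , suc b) → ¬ (p ≺ (s , b)) → p ≡ (s , b)
≺-west-neighbour (inj₁ lt) n = ⊥-elim (n (inj₁ lt))
≺-west-neighbour {s} {b} {s′ , b′} (inj₂ (refl , lt)) n with b′ <? b
... | yes l = ⊥-elim (n (inj₂ (refl , l)))
... | no l = cong (s ,_) (≤-antisym (≤-pred lt) (≮⇒≥ l))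

total : (Pos → ℕ → ℕ) → List (Pos × ℕ) → ℕ
total f [] = 0
total f ((p , e) ∷ zs) = f p e + total f zs

when : ∀ {P : Set} → Dec P → ℕ → ℕ
when d n = if does d then n else 0

ind : ∀ {P : Set} → Dec P → ℕ
ind d = when d 1

total-++ : ∀ f xs ys → total f (xs ++ ys) ≡ total f xs + total f ys
total-++ f [] ys = refl
total-++ f ((p , e) ∷ xs) ys rewrite total-++ f xs ys = sym (+-assoc (f p e) _ _)

total-+ : ∀ f g zs → total (λ p e → f p e + g p e) zs ≡ total f zs + total g zs
total-+ f g [] = refl
total-+ f g ((p , e) ∷ zs) rewrite total-+ f g zs = +-+-comm (f p e) (g p e) _ _
  where
  +-+-comm : ∀ a b c d → a + b + (c + d) ≡ a + c + (b + d)
  +-+-comm a b c d = begin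
    a + b + (c + d)   ≡⟨ +-assoc a b (c + d) ⟩
    a + (b + (c + d)) ≡⟨ cong (a +_) (sym (+-assoc b c d)) ⟩
    a + (b + c + d)   ≡⟨ cong (λ t → a + (t + d)) (+-comm b c) ⟩
    a + (c + b + d)   ≡⟨ cong (a +_) (+-assoc c b d) ⟩
    a + (c + (b + d)) ≡⟨ sym (+-assoc a c (b + d)) ⟩
    a + c + (b + d)   ∎
    where open ≡-Reasoning

total-mono : ∀ {P : Pos × ℕ → Set} {f g zs} → All P zs →
  (∀ {p e} → P (p , e) → f p e ≤ g p e) → total f zs ≤ total g zs
total-mono [] h = z≤n
total-mono {zs = (p , e) ∷ zs} (px ∷ a) h = +-mono-≤ (h px) (total-mono a h)

total-mono′ : ∀ {f g} zs → (∀ p e → f p e ≤ g p e) → total f zs ≤ total g zs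
total-mono′ [] h = z≤n
total-mono′ ((p , e) ∷ zs) h = +-mono-≤ (h p e) (total-mono′ zs h)

total-zero : ∀ zs → total (λ _ _ → 0) zs ≡ 0
total-zero [] = refl
total-zero (_ ∷ zs) = total-zero zs

total-vanish : ∀ {P : Pos × ℕ → Set} {f} zs → All P zs → (∀ {p e} → P (p , e) → f p e ≤ 0) →
  total f zs ≤ 0
total-vanish zs a h = ≤-trans (total-mono a h) (≤-reflexive (total-zero zs))

total-split₂ : ∀ {f g h} zs → (∀ p e → f p e ≤ g p e + h p e) → total f zs ≤ total g zs + total h zs
total-split₂ {f} {g} {h} zs H = ≤-trans (total-mono′ zs H) (≤-reflexive (total-+ g h zs))

total-split₃ : ∀ {f g h k} zs → (∀ p e → f p e ≤ g p e + h p e + k p e) →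
  total f zs ≤ total g zs + total h zs + total k zs
total-split₃ {f} {g} {h} {k} zs H =
  ≤-trans (total-split₂ zs H) (≤-reflexive (cong (_+ total k zs) (total-+ g h zs)))

total-merge : ∀ {f g h} zs → (∀ p e → f p e + g p e ≤ h p e) → total f zs + total g zs ≤ total h zs
total-merge {f} {g} zs H = ≤-trans (≤-reflexive (sym (total-+ f g zs))) (total-mono′ zs H)

total-middle : ∀ f xs ys zs → total f ys ≤ total f (xs ++ ys ++ zs)
total-middle f xs ys zs rewrite total-++ f xs (ys ++ zs) | total-++ f ys zs =
  ≤-trans (m≤m+n (total f ys) (total f zs)) (m≤n+m _ (total f xs))

total-∈ : ∀ f {p e} zs → (p , e) ∈ zs → f p e ≤ total f zs
total-∈ f ((p , e) ∷ zs) (here refl) = m≤m+n _ _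
total-∈ f ((p , e) ∷ zs) (there m) = ≤-trans (total-∈ f zs m) (m≤n+m _ _)

total-pos : ∀ f zs → 0 < total f zs → Any (λ z → 0 < f (proj₁ z) (proj₂ z)) zs
total-pos f ((p , e) ∷ zs) h with f p e in eq
... | suc k = here (subst (0 <_) (sym eq) (s≤s z≤n))
... | zero = there (total-pos f zs h)

when-yes : ∀ {P : Set} (P? : Dec P) n → P → n ≤ when P? n
when-yes (yes p) n _ = ≤-refl
when-yes (no p) n q = ⊥-elim (p q)

when-≤ : ∀ {P : Set} (P? : Dec P) n → when P? n ≤ n
when-≤ (yes p) n = ≤-refl
when-≤ (no p) n = z≤n

when-vanish : ∀ {P : Set} (P? : Dec P) n → (P → n ≤ 0) → when P? n ≤ 0
when-vanish (yes p) n f = f p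
when-vanish (no p) n f = z≤n

when-no : ∀ {P : Set} (P? : Dec P) n → ¬ P → when P? n ≤ 0
when-no P? n f = when-vanish P? n (⊥-elim ∘ f)

when-pos : ∀ {P : Set} (P? : Dec P) n → 0 < when P? n → P × 0 < n
when-pos (yes p) n h = p , h

ind-yes : ∀ {Q : Set} (Q? : Dec Q) → Q → ind Q? ≡ 1
ind-yes (yes q) _ = refl
ind-yes (no q) f = ⊥-elim (q f)

ind-no : ∀ {Q : Set} (Q? : Dec Q) → ¬ Q → ind Q? ≡ 0
ind-no (yes q) f = ⊥-elim (f q)
ind-no (no q) f = refl

when-disjoint : ∀ {P Q R : Set} (P? : Dec P) (Q? : Dec Q) (R? : Dec R) n → (P → R) → (Q → R) →
  (P → Q → ⊥) → when P? n + when Q? n ≤ when R? n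
when-disjoint (yes p) (yes q) R? n f g h = ⊥-elim (h p q)
when-disjoint (yes p) (no q) R? n f g h = ≤-trans (≤-reflexive (+-identityʳ n)) (when-yes R? n (f p))
when-disjoint (no p) (yes q) R? n f g h = when-yes R? n (g q)
when-disjoint (no p) (no q) R? n f g h = z≤n

when-cover₂ : ∀ {P Q R : Set} (R? : Dec R) (P? : Dec P) (Q? : Dec Q) n → (R → P ⊎ Q) →
  when R? n ≤ when P? n + when Q? n
when-cover₂ (no _) P? Q? n f = z≤n
when-cover₂ (yes r) P? Q? n f with f r
... | inj₁ p = ≤-trans (when-yes P? n p) (m≤m+n _ _)
... | inj₂ q = ≤-trans (when-yes Q? n q) (m≤n+m _ _)

when-cover₃ : ∀ {P Q R S : Set} (R? : Dec R) (P? : Dec P) (Q? : Dec Q) (S? : Dec S) n →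
  (R → P ⊎ Q ⊎ S) → when R? n ≤ when P? n + when Q? n + when S? n
when-cover₃ (no _) P? Q? S? n f = z≤n
when-cover₃ (yes r) P? Q? S? n f with f r
... | inj₁ p = ≤-trans (when-yes P? n p) (≤-trans (m≤m+n _ _) (m≤m+n _ _))
... | inj₂ (inj₁ q) = ≤-trans (when-yes Q? n q) (≤-trans (m≤n+m _ (when P? n)) (m≤m+n _ (when S? n)))
... | inj₂ (inj₂ s) = ≤-trans (when-yes S? n s) (m≤n+m _ _)

key : Pos × ℕ → Pos
key = proj₁

Sorted : List (Pos × ℕ) → Set
Sorted = AllPairs (λ z w → key z ≺ key w)

Sorted-++ˡ : ∀ {A B} → Sorted (A ++ B) → Sorted A
Sorted-++ˡ {[]} s = []
Sorted-++ˡ {a ∷ A} (x ∷ s) = ++⁻ˡ A x ∷ Sorted-++ˡ s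

Sorted-++ʳ : ∀ {A B} → Sorted (A ++ B) → Sorted B
Sorted-++ʳ {[]} s = s
Sorted-++ʳ {a ∷ A} (x ∷ s) = Sorted-++ʳ {A} s

Sorted-mid : ∀ {A z B} → Sorted (A ++ z ∷ B) →
  All (λ a → key a ≺ key z) A × All (λ b → key z ≺ key b) B
Sorted-mid {[]} (x ∷ s) = [] , x
Sorted-mid {a ∷ A} (x ∷ s) = (All.head (++⁻ʳ A x) ∷ proj₁ (Sorted-mid {A} s)) , proj₂ (Sorted-mid {A} s)

Sorted-split : ∀ y zs → Sorted zs → Σ (List (Pos × ℕ)) λ u1 → Σ (List (Pos × ℕ)) λ u2 →
   zs ≡ u1 ++ u2 × All (λ z → key z ≺ y) u1 × All (λ z → ¬ (key z ≺ y)) u2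
Sorted-split y [] _ = [] , [] , refl , [] , []
Sorted-split y (z ∷ zs) (x ∷ s) with key z ≺? y
... | yes h = let (u1 , u2 , e , a1 , a2) = Sorted-split y zs s
              in z ∷ u1 , u2 , cong (z ∷_) e , h ∷ a1 , a2
... | no h = [] , z ∷ zs , refl , [] , h ∷ All.map (λ zw wy → h (≺-trans zw wy)) x

Sorted-unique : ∀ q zs → Sorted zs → total (λ p e → when (p ≟ₚ q) 1) zs ≤ 1
Sorted-unique q [] _ = z≤n
Sorted-unique q ((p , e) ∷ zs) (h ∷ s) with p ≟ₚ q
... | no _ = Sorted-unique q zs s
... | yes refl = s≤s (total-vanish zs h (λ {p′} lt → when-no (p′ ≟ₚ p) 1 (λ { refl → ≺-irrefl lt })))

adjacent-head : ∀ {z w} v → Sorted (z ∷ v) → w ∈ v → (∀ {q} → key z ≺ q → q ≺ key w → ⊥) →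
  Σ (List (Pos × ℕ)) λ v′ → v ≡ w ∷ v′
adjacent-head v s m nothing-between with ∈-∃++ m
... | [] , v2 , eq = v2 , eq
... | z′ ∷ v1 , v2 , refl with s
... | (z≺z′ ∷ _) ∷ (z′≺ ∷ _) = ⊥-elim (nothing-between z≺z′ (All.head (++⁻ʳ v1 z′≺)))

nth-length : ∀ {A : Set} (l : List A) s {a} → nth l s ≡ just a → s < length l
nth-length (x ∷ l) zero h = s≤s z≤n
nth-length (x ∷ l) (suc s) h = s≤s (nth-length l s h)

nth-exists : ∀ {A : Set} (l : List A) m → m < length l → Σ A λ a → nth l m ≡ just a
nth-exists (x ∷ l) zero h = x , refl
nth-exists (x ∷ l) (suc m) (s≤s h) = nth-exists l m h

entryAt : Maybe (ℕ × List ℕ) → ℕ → Maybe ℕ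
entryAt nothing c = nothing
entryAt (just (o , es)) c = if c <ᵇ o then nothing else nth es (c ∸ o)

entry-def : ∀ T r c → entry T (r , c) ≡ entryAt (nth (rows T) r) c
entry-def T r c with nth (rows T) r
... | nothing = refl
... | just _ = refl

entry-box : ∀ {T r c o es} → nth (rows T) r ≡ just (o , es) → o ≤ c → entry T (r , c) ≡ nth es (c ∸ o)
entry-box {T} {r} {c} eq h rewrite entry-def T r c | eq | <ᵇ-false h = refl

entry-inv : ∀ {T r c v} → entry T (r , c) ≡ just v →
  Σ ℕ λ o → Σ (List ℕ) λ es → nth (rows T) r ≡ just (o , es) × o ≤ c × nth es (c ∸ o) ≡ just v
entry-inv {T} {r} {c} {v} h with nth (rows T) r | entry-def T r c
... | just (o , es) | d with c <ᵇ o in lt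
... | false = o , es , refl , ≮⇒≥ (λ c<o → subst Tb lt (<⇒<ᵇ c<o)) , trans (sym d) h
entry-inv {T} {r} {c} {v} h | just (o , es) | d | true = case trans (sym d) h of λ ()
entry-inv {T} {r} {c} {v} h | nothing | d = case trans (sym d) h of λ ()

entry-row< : ∀ {T s b v} → entry T (s , b) ≡ just v → s < length (rows T)
entry-row< {T} {s} h = let (_ , _ , e , _) = entry-inv {T} h in nth-length (rows T) s e

box-info : ∀ {T s b v} → entry T (s , b) ≡ just v →
  Σ ℕ λ o → Σ (List ℕ) λ es → nth (rows T) s ≡ just (o , es) × o ≤ b × b < o + length es
box-info {T} {s} {b} h with entry-inv {T} h
... | o , es , e1 , ob , e2 = o , es , e1 , ob ,
   subst (_< o + length es) (m+[n∸m]≡n ob) (+-monoʳ-< o (nth-length es (b ∸ o) e2))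

box-from : ∀ {T s b o es} → nth (rows T) s ≡ just (o , es) → o ≤ b → b < o + length es →
  Σ ℕ λ v → entry T (s , b) ≡ just v
box-from {T} {s} {b} {o} {es} e ob bl =
  let (v , ev) = nth-exists es (b ∸ o) (+-cancelˡ-< o _ _ (subst (_< o + length es) (sym (m+[n∸m]≡n ob)) bl))
  in v , trans (entry-box {T} {s} {b} e ob) ev

shape-adj : ∀ rs s {o1 e1 o2 e2} → ShapeOK rs → nth rs s ≡ just (o1 , e1) → nth rs (suc s) ≡ just (o2 , e2) →
  o2 ≤ o1 × o2 + length e2 ≤ o1 + length e1
shape-adj ((o1 , e1) ∷ (o2 , e2) ∷ rs) zero (a , b , _) refl refl = a , b
shape-adj (_ ∷ r2 ∷ rs) (suc s) (a , b , c) e1 e2 = shape-adj (r2 ∷ rs) s c e1 e2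

shape-mono : ∀ rs d s {o1 e1 o2 e2} → ShapeOK rs → nth rs s ≡ just (o1 , e1) → nth rs (d + s) ≡ just (o2 , e2) →
  o2 ≤ o1 × o2 + length e2 ≤ o1 + length e1
shape-mono rs zero s ok e1 e2 with trans (sym e1) e2
... | refl = ≤-refl , ≤-refl
shape-mono rs (suc d) s ok e1 e2 =
  let ((o3 , e3) , eq3) = nth-exists rs (d + s) (<-trans (n<1+n (d + s)) (nth-length rs (suc (d + s)) e2))
      (a1 , b1) = shape-mono rs d s ok e1 eq3
      (a2 , b2) = shape-adj rs (d + s) ok eq3 e2
  in ≤-trans a2 a1 , ≤-trans b2 b1

W : Tableau → List (Pos × ℕ)
W T = concat (reverse (indexedRows 0 (rows T)))

Good : Tableau → Pos × ℕ → Set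
Good T z = entry T (proj₁ z) ≡ just (proj₂ z)

All-reverse : ∀ {A : Set} {P : A → Set} {L : List A} → All P L → All P (reverse L)
All-reverse a = All.tabulate (λ m → All.lookup a (reverse⁻ m))

rowCells-good : ∀ rs k o es0 → nth rs k ≡ just (o , es0) → ∀ c es → o ≤ c →
  (∀ m → nth es0 (c ∸ o + m) ≡ nth es m) → All (Good (mkT rs)) (rowCells k c es)
rowCells-good rs k o es0 eq c [] oc h = []
rowCells-good rs k o es0 eq c (e ∷ es) oc h =
  trans (entry-box {mkT rs} {k} {c} eq oc) (trans (cong (nth es0) (sym (+-identityʳ _))) (h 0))
  ∷ rowCells-good rs k o es0 eq (suc c) es (m≤n⇒m≤1+n oc)
      (λ m → trans (cong (λ t → nth es0 (t + m)) (+-∸-assoc 1 oc))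
              (trans (cong (nth es0) (sym (+-suc (c ∸ o) m))) (h (suc m))))

indexedRows-good : ∀ rs0 k rs → (∀ t → nth rs0 (k + t) ≡ nth rs t) →
  All (All (Good (mkT rs0))) (indexedRows k rs)
indexedRows-good rs0 k [] h = []
indexedRows-good rs0 k ((o , es) ∷ rs) h =
  rowCells-good rs0 k o es (trans (cong (nth rs0) (sym (+-identityʳ k))) (h 0)) o es ≤-refl
    (λ m → cong (λ t → nth es (t + m)) (n∸n≡0 o))
  ∷ indexedRows-good rs0 (suc k) rs (λ t → trans (cong (nth rs0) (sym (+-suc k t))) (h (suc t)))

W-sound : ∀ T → All (Good T) (W T)
W-sound T = concat⁺ (All-reverse (indexedRows-good (rows T) 0 (rows T) (λ t → refl)))

rowCells-complete : ∀ k c es m {v} → nth es m ≡ just v → ((k , c + m) , v) ∈ rowCells k c es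
rowCells-complete k c (e ∷ es) zero refl rewrite +-identityʳ c = here refl
rowCells-complete k c (e ∷ es) (suc m) h rewrite +-suc c m = there (rowCells-complete k (suc c) es m h)

indexedRows-complete : ∀ k rs t {o es} → nth rs t ≡ just (o , es) → rowCells (k + t) o es ∈ indexedRows k rs
indexedRows-complete k ((o , es) ∷ rs) zero refl rewrite +-identityʳ k = here refl
indexedRows-complete k (r ∷ rs) (suc t) h rewrite +-suc k t = there (indexedRows-complete (suc k) rs t h)

W-complete : ∀ T {p v} → entry T p ≡ just v → (p , v) ∈ W T
W-complete T {s , b} {v} h with entry-inv {T} h
... | o , es , e1 , ob , e2 =
  ∈-concat⁺′ (subst (λ p → (p , v) ∈ rowCells s o es) (cong (s ,_) (m+[n∸m]≡n ob)) (rowCells-complete s o es (b ∸ o) e2))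
             (reverse⁺ (indexedRows-complete 0 (rows T) s e1))

rowCells-sorted : ∀ k c es →
  Sorted (rowCells k c es) × All (λ z → proj₁ (key z) ≡ k × c ≤ proj₂ (key z)) (rowCells k c es)
rowCells-sorted k c [] = [] , []
rowCells-sorted k c (e ∷ es) with rowCells-sorted k (suc c) es
... | s , a = (All.map (λ { (refl , l) → inj₂ (refl , l) }) a ∷ s) , ((refl , ≤-refl) ∷ All.map (λ { (r , l) → r , <⇒≤ l }) a)

indexedRows-sorted : ∀ k rs → Sorted (concat (reverse (indexedRows k rs))) ×
  All (λ z → k ≤ proj₁ (key z)) (concat (reverse (indexedRows k rs)))
indexedRows-sorted k [] = [] , []
indexedRows-sorted k ((o , es) ∷ rs) with indexedRows-sorted (suc k) rs | rowCells-sorted k o es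
... | sA , aA | sR , aR
  rewrite unfold-reverse (rowCells k o es) (indexedRows (suc k) rs)
        | sym (concat-++ (reverse (indexedRows (suc k) rs)) (rowCells k o es ∷ []))
        | ++-identityʳ (rowCells k o es)
  = AllPairs.++⁺ sA sR (All.map (λ {a} ka → All.map (λ { (rb , _) → inj₁ (subst (_< proj₁ (key a)) (sym rb) ka) }) aR) aA)
  , ++⁺ (All.map <⇒≤ aA) (All.map (λ { (rb , _) → ≤-reflexive (sym rb) }) aR)

W-sorted : ∀ T → Sorted (W T)
W-sorted T = proj₁ (indexedRows-sorted 0 (rows T))

-- Bracketing.  'pending i j k w' is the number of unmatched letters j after
-- scanning w from left to right, starting with k of them; it follows the
-- recursion of unbracketedI.

pending : ℕ → ℕ → ℕ → List (Pos × ℕ) → ℕ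
pending i j k [] = k
pending i j k ((p , e) ∷ w) =
  if e ≡ᵇ unp j then pending i j (suc k) w
  else (if e ≡ᵇ unp i then step k else pending i j k w)
  where
  step : ℕ → ℕ
  step zero    = pending i j zero w
  step (suc k) = pending i j k w

pending-++ : ∀ i j k u w → pending i j k (u ++ w) ≡ pending i j (pending i j k u) w
pending-++ i j k [] w = refl
pending-++ i j k ((p , e) ∷ u) w with e ≡ᵇ unp j
... | true = pending-++ i j (suc k) u w
... | false with e ≡ᵇ unp i
... | false = pending-++ i j k u w
pending-++ i j zero ((p , e) ∷ u) w | false | true = pending-++ i j zero u w
pending-++ i j (suc k) ((p , e) ∷ u) w | false | true = pending-++ i j k u w

unbracketed-keep : ∀ i j k w →
  unbracketedI i j k (keepCodes (λ e → (e ≡ᵇ unp i) ∨ (e ≡ᵇ unp j)) w) ≡ unbracketedI i j k w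
unbracketed-keep i j k [] = refl
unbracketed-keep i j k ((p , e) ∷ w) with e ≡ᵇ unp i in ei | e ≡ᵇ unp j in ej
... | false | false = unbracketed-keep i j k w
... | false | true rewrite ej = unbracketed-keep i j (suc k) w
... | true | true rewrite ej = unbracketed-keep i j (suc k) w
unbracketed-keep i j zero ((p , e) ∷ w) | true | false rewrite ej | ei = cong (p ∷_) (unbracketed-keep i j zero w)
unbracketed-keep i j (suc k) ((p , e) ∷ w) | true | false rewrite ej | ei = unbracketed-keep i j k w

pending-j : ∀ {i j k p e u} → (e ≡ᵇ unp j) ≡ true → pending i j k ((p , e) ∷ u) ≡ pending i j (suc k) u
pending-j eq rewrite eq = refl

pending-other : ∀ {i j k p e u} → (e ≡ᵇ unp j) ≡ false → (e ≡ᵇ unp i) ≡ false →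
  pending i j k ((p , e) ∷ u) ≡ pending i j k u
pending-other eq eq2 rewrite eq | eq2 = refl

pending-i-unmatched : ∀ {i j p e u} → (e ≡ᵇ unp j) ≡ false → (e ≡ᵇ unp i) ≡ true →
  pending i j 0 ((p , e) ∷ u) ≡ pending i j 0 u
pending-i-unmatched eq eq2 rewrite eq | eq2 = refl

pending-i-matched : ∀ {i j k p e u} → (e ≡ᵇ unp j) ≡ false → (e ≡ᵇ unp i) ≡ true →
  pending i j (suc k) ((p , e) ∷ u) ≡ pending i j k u
pending-i-matched eq eq2 rewrite eq | eq2 = refl

last-unbracketed-split : ∀ i k w x → last (unbracketedI i (suc i) k w) ≡ just x →
  Σ (List (Pos × ℕ)) λ u → Σ (List (Pos × ℕ)) λ v →
    w ≡ u ++ (x , unp i) ∷ v × pending i (suc i) k u ≡ 0 × unbracketedI i (suc i) 0 v ≡ []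
last-unbracketed-split i k ((p , e) ∷ w) x h with e ≡ᵇ unp (suc i) in ej
... | true = let (u , v , eq , r , n) = last-unbracketed-split i (suc k) w x h
             in (p , e) ∷ u , v , cong ((p , e) ∷_) eq , trans (pending-j {p = p} {e = e} {u = u} ej) r , n
... | false with e ≡ᵇ unp i in ei
... | false = let (u , v , eq , r , n) = last-unbracketed-split i k w x h
              in (p , e) ∷ u , v , cong ((p , e) ∷_) eq , trans (pending-other {p = p} {e = e} {u = u} ej ei) r , n
last-unbracketed-split i (suc k) ((p , e) ∷ w) x h | false | true =
  let (u , v , eq , r , n) = last-unbracketed-split i k w x h
  in (p , e) ∷ u , v , cong ((p , e) ∷_) eq , trans (pending-i-matched {p = p} {e = e} {u = u} ej ei) r , n
last-unbracketed-split i zero ((p , e) ∷ w) x h | false | true with unbracketedI i (suc i) zero w in eL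
... | [] = [] , w , cong₂ (λ a b → (a , b) ∷ w) (just-injective h) (≡ᵇ⇒≡ e (unp i) (true⇒T ei)) , refl , eL
... | l ∷ L = let (u , v , eq , r , n) = last-unbracketed-split i zero w x (trans (cong last eL) h)
              in (p , e) ∷ u , v , cong ((p , e) ∷_) eq , trans (pending-i-unmatched {p = p} {e = e} {u = u} ej ei) r , n

record SplitAt (i : ℕ) (T : Tableau) (x : Pos) : Set where
  field
    before after    : List (Pos × ℕ)
    word-split      : W T ≡ before ++ (x , unp i) ∷ after
    closed          : pending i (suc i) 0 before ≡ 0
    after-bracketed : unbracketedI i (suc i) 0 after ≡ []

rightmost-split : ∀ i T x → rightmostUnbracketed i T ≡ just x → SplitAt i T x
rightmost-split i T x hx =
  let (u , v , hW , hrun , hv) = last-unbracketed-split i 0 (W T) x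
        (trans (cong last (sym (unbracketed-keep i (suc i) 0 (W T)))) hx)
  in record { before = u ; after = v ; word-split = hW ; closed = hrun ; after-bracketed = hv }

unbracketed-first-i : ∀ i p w → unbracketedI i (suc i) 0 ((p , unp i) ∷ w) ≡ p ∷ unbracketedI i (suc i) 0 w
unbracketed-first-i i p w rewrite ≡ᵇ-false (unp-suc-≢ i ∘ sym) | ≡ᵇ-true {unp i} refl = refl

occ : ℕ → List (Pos × ℕ) → ℕ
occ v = total (λ _ e → ind (e ≟ v))

-- Each j opens a pending bracket and each i closes at most one.
pending-bound : ∀ i k w → occ (unp (suc i)) w + k ≤ pending i (suc i) k w + occ (unp i) w
pending-bound i k [] = ≤-reflexive (sym (+-identityʳ k))
pending-bound i k ((p , e) ∷ w) with e ≟ unp (suc i)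
... | yes h rewrite ≡ᵇ-true h | ≡ᵇ-false {e} {unp i} (λ h2 → unp-suc-≢ i (trans (sym h) h2)) =
  subst (λ t → t ≤ pending i (suc i) (suc k) w + occ (unp i) w) (+-suc _ k) (pending-bound i (suc k) w)
... | no h rewrite ≡ᵇ-false h with e ≟ unp i
... | no h2 rewrite ≡ᵇ-false h2 = pending-bound i k w
pending-bound i zero ((p , e) ∷ w) | no h | yes h2 rewrite ≡ᵇ-true h2 =
  ≤-trans (pending-bound i zero w) (+-monoʳ-≤ _ (n≤1+n _))
pending-bound i (suc k) ((p , e) ∷ w) | no h | yes h2 rewrite ≡ᵇ-true h2 =
  ≤-trans (≤-reflexive (+-suc _ k)) (≤-trans (s≤s (pending-bound i k w)) (≤-reflexive (sym (+-suc _ _))))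

suffix-balanced : ∀ i u1 u2 → pending i (suc i) 0 (u1 ++ u2) ≡ 0 → occ (unp (suc i)) u2 ≤ occ (unp i) u2
suffix-balanced i u1 u2 h =
  let k1 = pending i (suc i) 0 u1
      closes : pending i (suc i) k1 u2 ≡ 0
      closes = trans (sym (pending-++ i (suc i) 0 u1 u2)) h
  in ≤-trans (m≤m+n _ k1) (≤-trans (pending-bound i k1 u2) (≤-reflexive (cong (_+ occ (unp i) u2) closes)))

module TableauFacts (T : Tableau) (PT : IsPrimedTableau T) where
  open IsPrimedTableau PT

  box-down : ∀ {s col b u v} → entry T (s , col) ≡ just u → entry T (suc s , b) ≡ just v → col ≤ b →
    Σ ℕ λ w → entry T (suc s , col) ≡ just w
  box-down {s} e1 e2 cb =
    let (o1 , _ , n1 , a1 , _) = box-info {T} e1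
        (o2 , _ , n2 , a2 , b2) = box-info {T} e2
        (x1 , _) = shape-adj (rows T) s shape n1 n2
    in box-from {T} n2 (≤-trans x1 a1) (≤-<-trans cb b2)

  box-row : ∀ {s b1 b2 b u v} → entry T (s , b1) ≡ just u → entry T (s , b2) ≡ just v → b1 ≤ b → b ≤ b2 →
    Σ ℕ λ w → entry T (s , b) ≡ just w
  box-row e1 e2 h1 h2 with box-info {T} e1 | box-info {T} e2
  ... | _ , _ , n1 , a1 , _ | _ , _ , n2 , _ , b2 with trans (sym n1) n2
  ... | refl = box-from {T} n1 (≤-trans a1 h1) (≤-<-trans h2 b2)

  box-below : ∀ {s s2 b u w} → entry T (s , b) ≡ just u → entry T (s2 , b) ≡ just w → s < s2 →
    Σ ℕ λ z → entry T (suc s , b) ≡ just z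
  box-below {s} {s2} e1 e2 lt =
    let (o1 , _ , n1 , a1 , _) = box-info {T} e1
        (o2 , es2 , n2 , _ , b2) = box-info {T} e2
        ((o3 , e3) , eq3) = nth-exists (rows T) (suc s) (≤-<-trans lt (nth-length (rows T) _ n2))
        (x1 , _) = shape-adj (rows T) s shape n1 eq3
        (_ , y2) = shape-mono (rows T) (s2 ∸ suc s) (suc s) shape eq3
                     (subst (λ t → nth (rows T) t ≡ just (o2 , es2)) (sym (m∸n+n≡m lt)) n2)
    in box-from {T} eq3 (≤-trans x1 a1) (<-≤-trans b2 y2)

  colMonoBy : ∀ d {s b u v} → entry T (s , b) ≡ just u → entry T (d + s , b) ≡ just v → u ≤ v
  colMonoBy zero e1 e2 = ≤-reflexive (just-injective (trans (sym e1) e2))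
  colMonoBy (suc d) {s} {b} {u} {v} e1 e2 =
    let (w , ew) = box-below e1 e2 (s≤s (m≤n+m s d))
    in ≤-trans (colWeak s b u w e1 ew)
               (colMonoBy d ew (subst (λ t → entry T (t , b) ≡ just v) (sym (+-suc d s)) e2))

  rowMonoBy : ∀ d {s b u v} → entry T (s , b) ≡ just u → entry T (s , d + b) ≡ just v → u ≤ v
  rowMonoBy zero e1 e2 = ≤-reflexive (just-injective (trans (sym e1) e2))
  rowMonoBy (suc d) {s} {b} {u} {v} e1 e2 =
    let (w , ew) = box-row e1 e2 (n≤1+n b) (s≤s (m≤n+m b d))
    in ≤-trans (rowWeak s b u w e1 ew)
               (rowMonoBy d ew (subst (λ t → entry T (s , t) ≡ just v) (sym (+-suc d b)) e2))

  colMono : ∀ {s1 s2 b u v} → s1 ≤ s2 → entry T (s1 , b) ≡ just u → entry T (s2 , b) ≡ just v → u ≤ v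
  colMono {s1} {s2} {b} {u} {v} h e1 e2 =
    colMonoBy (s2 ∸ s1) e1 (subst (λ t → entry T (t , b) ≡ just v) (sym (m∸n+n≡m h)) e2)

  rowMono : ∀ {s b1 b2 u v} → b1 ≤ b2 → entry T (s , b1) ≡ just u → entry T (s , b2) ≡ just v → u ≤ v
  rowMono {s} {b1} {b2} {u} {v} h e1 e2 =
    rowMonoBy (b2 ∸ b1) e1 (subst (λ t → entry T (s , t) ≡ just v) (sym (m∸n+n≡m h)) e2)

updAt-same : ∀ g n es {v} → nth es n ≡ just v → nth (updAt g n es) n ≡ just (g v)
updAt-same g zero (e ∷ es) refl = refl
updAt-same g (suc n) (e ∷ es) h = updAt-same g n es h

updAt-other : ∀ g n es m → m ≢ n → nth (updAt g n es) m ≡ nth es m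
updAt-other g n [] m h = refl
updAt-other g zero (e ∷ es) zero h = ⊥-elim (h refl)
updAt-other g zero (e ∷ es) (suc m) h = refl
updAt-other g (suc n) (e ∷ es) zero h = refl
updAt-other g (suc n) (e ∷ es) (suc m) h = updAt-other g n es m (h ∘ cong suc)

updAt-length : ∀ g n es → length (updAt g n es) ≡ length es
updAt-length g n [] = refl
updAt-length g zero (e ∷ es) = refl
updAt-length g (suc n) (e ∷ es) = cong suc (updAt-length g n es)

updAt-cong : ∀ g h n es {v} → nth es n ≡ just v → g v ≡ h v → updAt g n es ≡ updAt h n es
updAt-cong g h zero (e ∷ es) refl q = cong (_∷ es) q
updAt-cong g h (suc n) (e ∷ es) en q = cong (e ∷_) (updAt-cong g h n es en q)

updAt-comp : ∀ g h n es → updAt g n (updAt h n es) ≡ updAt (g ∘ h) n es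
updAt-comp g h n [] = refl
updAt-comp g h zero (e ∷ es) = refl
updAt-comp g h (suc n) (e ∷ es) = cong (e ∷_) (updAt-comp g h n es)

updRows-same : ∀ g r c rs {o es} → nth rs r ≡ just (o , es) → o ≤ c →
  nth (updRows g r c rs) r ≡ just (o , updAt g (c ∸ o) es)
updRows-same g zero c ((o , es) ∷ rs) refl oc rewrite <ᵇ-false {c} {o} oc = refl
updRows-same g (suc r) c (x ∷ rs) h oc = updRows-same g r c rs h oc

updRows-other : ∀ g r c rs r′ → r′ ≢ r → nth (updRows g r c rs) r′ ≡ nth rs r′
updRows-other g r c [] r′ h = refl
updRows-other g zero c (x ∷ rs) zero h = ⊥-elim (h refl)
updRows-other g zero c (x ∷ rs) (suc r′) h = refl
updRows-other g (suc r) c (x ∷ rs) zero h = refl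
updRows-other g (suc r) c (x ∷ rs) (suc r′) h = updRows-other g r c rs r′ (h ∘ cong suc)

entry-modify-same : ∀ g T r c {v} → entry T (r , c) ≡ just v → entry (modifyEntry g (r , c) T) (r , c) ≡ just (g v)
entry-modify-same g T r c h with entry-inv {T} h
... | o , es , e1 , oc , e2 =
  trans (entry-box {modifyEntry g (r , c) T} {r} {c} (updRows-same g r c (rows T) e1 oc) oc) (updAt-same g (c ∸ o) es e2)

entry-modify-other : ∀ g T r c {v} p → entry T (r , c) ≡ just v → p ≢ (r , c) →
  entry (modifyEntry g (r , c) T) p ≡ entry T p
entry-modify-other g T r c (r′ , c′) h ne with r′ ≟ r
... | no rr = trans (entry-def (modifyEntry g (r , c) T) r′ c′)
                (trans (cong (λ m → entryAt m c′) (updRows-other g r c (rows T) r′ rr)) (sym (entry-def T r′ c′)))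
... | yes refl with entry-inv {T} h
... | o , es , e1 , oc , e2 =
  trans (entry-def (modifyEntry g (r , c) T) r c′)
   (trans (cong (λ m → entryAt m c′) (updRows-same g r c (rows T) e1 oc))
   (trans same-row (sym (trans (entry-def T r c′) (cong (λ m → entryAt m c′) e1)))))
  where
  same-row : entryAt (just (o , updAt g (c ∸ o) es)) c′ ≡ entryAt (just (o , es)) c′
  same-row with c′ <ᵇ o in eq
  ... | true = refl
  ... | false = updAt-other g (c ∸ o) es (c′ ∸ o)
        (λ q → ne (cong (r ,_) (∸-cancelʳ-≡ (≮⇒≥ (λ lt → subst Tb eq (<⇒<ᵇ lt))) oc q)))

shapeOf : List (ℕ × List ℕ) → List (ℕ × ℕ)
shapeOf = map (λ z → proj₁ z , length (proj₂ z))

ShapeOK-transfer : ∀ rs rs′ → shapeOf rs ≡ shapeOf rs′ → ShapeOK rs → ShapeOK rs′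
ShapeOK-transfer [] [] e ok = ok
ShapeOK-transfer (_ ∷ []) (_ ∷ []) e ok = ok
ShapeOK-transfer ((o1 , e1) ∷ (o2 , e2) ∷ rs) ((o1′ , e1′) ∷ (o2′ , e2′) ∷ rs′) e (a , b , c) =
  let h1 = ∷-injectiveˡ e
      t1 = ∷-injectiveʳ e
      h2 = ∷-injectiveˡ t1
      q1 = cong proj₁ h1 ; l1 = cong proj₂ h1
      q2 = cong proj₁ h2 ; l2 = cong proj₂ h2
  in subst₂ _≤_ q2 q1 a , subst₂ _≤_ (cong₂ _+_ q2 l2) (cong₂ _+_ q1 l1) b ,
     ShapeOK-transfer ((o2 , e2) ∷ rs) ((o2′ , e2′) ∷ rs′) t1 c
ShapeOK-transfer (_ ∷ []) (_ ∷ _ ∷ _) () ok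
ShapeOK-transfer (_ ∷ _ ∷ _) (_ ∷ []) () ok

updRows-shape : ∀ g r c rs → shapeOf (updRows g r c rs) ≡ shapeOf rs
updRows-shape g r c [] = refl
updRows-shape g zero c ((o , es) ∷ rs) with c <ᵇ o
... | true = refl
... | false = cong (λ n → (o , n) ∷ shapeOf rs) (updAt-length g (c ∸ o) es)
updRows-shape g (suc r) c (x ∷ rs) = cong (_ ∷_) (updRows-shape g r c rs)

modify-shape : ∀ g p T → ShapeOK (rows T) → ShapeOK (rows (modifyEntry g p T))
modify-shape g (r , c) T ok = ShapeOK-transfer (rows T) _ (sym (updRows-shape g r c (rows T))) ok

modify-cong : ∀ g h T r c {v} → entry T (r , c) ≡ just v → g v ≡ h v →
  modifyEntry g (r , c) T ≡ modifyEntry h (r , c) T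
modify-cong g h T r c e q with entry-inv {T} e
... | o , es , e1 , oc , e2 = cong mkT (rows-cong (rows T) r e1)
  where
  rows-cong : ∀ rs r → nth rs r ≡ just (o , es) → updRows g r c rs ≡ updRows h r c rs
  rows-cong ((o , es) ∷ rs) zero refl rewrite <ᵇ-false {c} {o} oc = cong (λ z → (o , z) ∷ rs) (updAt-cong g h (c ∸ o) es e2 q)
  rows-cong (x ∷ rs) (suc r) n = cong (x ∷_) (rows-cong rs r n)

modify-comp : ∀ g h p T → modifyEntry g p (modifyEntry h p T) ≡ modifyEntry (g ∘ h) p T
modify-comp g h (r , c) T = cong mkT (rows-comp (rows T) r)
  where
  rows-comp : ∀ rs r → updRows g r c (updRows h r c rs) ≡ updRows (g ∘ h) r c rs
  rows-comp [] r = refl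
  rows-comp ((o , es) ∷ rs) zero with c <ᵇ o in eq
  ... | true rewrite eq = refl
  ... | false rewrite eq = cong (λ z → (o , z) ∷ rs) (updAt-comp g h (c ∸ o) es)
  rows-comp (x ∷ rs) (suc r) = cong (x ∷_) (rows-comp rs r)

halfUp-set : ∀ T r c {w} → entry T (r , c) ≡ just w → halfUp (r , c) T ≡ setEntry (r , c) (suc w) T
halfUp-set T r c e = modify-cong suc _ T r c e refl

halfUp-twice : ∀ T r c {w} → entry T (r , c) ≡ just w →
  halfUp (r , c) (halfUp (r , c) T) ≡ setEntry (r , c) (suc (suc w)) T
halfUp-twice T r c e = trans (modify-comp suc suc (r , c) T) (modify-cong (suc ∘ suc) _ T r c e refl)

set-same : ∀ T r c v {w} → entry T (r , c) ≡ just w → entry (setEntry (r , c) v T) (r , c) ≡ just v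
set-same T r c v h = entry-modify-same (λ _ → v) T r c h

set-other : ∀ T r c v {w} → entry T (r , c) ≡ just w → ∀ p → p ≢ (r , c) →
  entry (setEntry (r , c) v T) p ≡ entry T p
set-other T r c v h p ne = entry-modify-other (λ _ → v) T r c p h ne

set-view : ∀ T r c v {w} → entry T (r , c) ≡ just w → ∀ p u → entry (setEntry (r , c) v T) p ≡ just u →
  (p ≡ (r , c) × u ≡ v) ⊎ (p ≢ (r , c) × entry T p ≡ just u)
set-view T r c v h p u e with p ≟ₚ (r , c)
... | yes refl = inj₁ (refl , just-injective (trans (sym e) (set-same T r c v h)))
... | no ne = inj₂ (ne , trans (sym (set-other T r c v h p ne)) e)

record Fits (T : Tableau) (r c v : ℕ) : Set where
  field
    positive  : 1 ≤ v
    fromWest  : ∀ {c′ u} → suc c′ ≡ c → entry T (r , c′) ≡ just u → u ≤ v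
    toEast    : ∀ {u} → entry T (r , suc c) ≡ just u → v ≤ u
    fromNorth : ∀ {r′ u} → suc r′ ≡ r → entry T (r′ , c) ≡ just u → u ≤ v
    toSouth   : ∀ {u} → entry T (suc r , c) ≡ just u → v ≤ u
    primeOnce : ∀ {c′ k} → c′ ≢ c → v ≡ prim k → entry T (r , c′) ≡ just v → ⊥
    unpOnce   : ∀ {r′ k} → r′ ≢ r → v ≡ unp k → entry T (r′ , c) ≡ just v → ⊥

-- Writing a fitting entry into a box of a primed tableau gives a primed
-- tableau: every axiom involving the changed box is one of the conditions.
set-preserves-tableau : ∀ T r c v {w} → IsPrimedTableau T → entry T (r , c) ≡ just w → Fits T r c v →
  IsPrimedTableau (setEntry (r , c) v T)
set-preserves-tableau T r c v {w} PT h fits = record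
  { shape     = modify-shape (λ _ → v) (r , c) T shape
  ; entriesOK = λ p u e → [ (λ { (_ , refl) → positive }) , (λ { (_ , e′) → entriesOK p u e′ }) ]′ (view p u e)
  ; rowWeak   = row-weak
  ; colWeak   = col-weak
  ; rowPrime  = row-prime
  ; colUnp    = col-unp
  }
  where
  open IsPrimedTableau PT
  open Fits fits
  view = set-view T r c v h

  row-weak : ∀ r₁ c₁ u₁ v₁ → entry (setEntry (r , c) v T) (r₁ , c₁) ≡ just u₁ →
    entry (setEntry (r , c) v T) (r₁ , suc c₁) ≡ just v₁ → u₁ ≤ v₁
  row-weak r₁ c₁ u₁ v₁ e1 e2 with view _ _ e1 | view _ _ e2
  ... | inj₁ (refl , refl) | inj₁ (q , _) = ⊥-elim (<⇒≢ (n<1+n c₁) (sym (cong proj₂ q)))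
  ... | inj₁ (refl , refl) | inj₂ (_ , e′) = toEast e′
  ... | inj₂ (_ , e′) | inj₁ (refl , refl) = fromWest refl e′
  ... | inj₂ (_ , e′) | inj₂ (_ , e″) = rowWeak r₁ c₁ u₁ v₁ e′ e″

  col-weak : ∀ r₁ c₁ u₁ v₁ → entry (setEntry (r , c) v T) (r₁ , c₁) ≡ just u₁ →
    entry (setEntry (r , c) v T) (suc r₁ , c₁) ≡ just v₁ → u₁ ≤ v₁
  col-weak r₁ c₁ u₁ v₁ e1 e2 with view _ _ e1 | view _ _ e2
  ... | inj₁ (refl , refl) | inj₁ (q , _) = ⊥-elim (<⇒≢ (n<1+n r₁) (sym (cong proj₁ q)))
  ... | inj₁ (refl , refl) | inj₂ (_ , e′) = toSouth e′
  ... | inj₂ (_ , e′) | inj₁ (refl , refl) = fromNorth refl e′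
  ... | inj₂ (_ , e′) | inj₂ (_ , e″) = colWeak r₁ c₁ u₁ v₁ e′ e″

  row-prime : ∀ r₁ c₁ c₂ k → c₁ < c₂ → entry (setEntry (r , c) v T) (r₁ , c₁) ≡ just (prim k) →
    entry (setEntry (r , c) v T) (r₁ , c₂) ≡ just (prim k) → ⊥
  row-prime r₁ c₁ c₂ k lt e1 e2 with view _ _ e1 | view _ _ e2
  ... | inj₁ (refl , q) | inj₁ (q′ , _) = <⇒≢ lt (sym (cong proj₂ q′))
  ... | inj₁ (refl , q) | inj₂ (ne , e′) =
    primeOnce {k = k} (ne ∘ cong (r ,_)) (sym q) (subst (λ t → entry T (r , c₂) ≡ just t) q e′)
  ... | inj₂ (ne , e′) | inj₁ (refl , q) =
    primeOnce {k = k} (ne ∘ cong (r ,_)) (sym q) (subst (λ t → entry T (r , c₁) ≡ just t) q e′)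
  ... | inj₂ (_ , e′) | inj₂ (_ , e″) = rowPrime r₁ c₁ c₂ k lt e′ e″

  col-unp : ∀ r₁ r₂ c₁ k → r₁ < r₂ → entry (setEntry (r , c) v T) (r₁ , c₁) ≡ just (unp k) →
    entry (setEntry (r , c) v T) (r₂ , c₁) ≡ just (unp k) → ⊥
  col-unp r₁ r₂ c₁ k lt e1 e2 with view _ _ e1 | view _ _ e2
  ... | inj₁ (refl , q) | inj₁ (q′ , _) = <⇒≢ lt (sym (cong proj₁ q′))
  ... | inj₁ (refl , q) | inj₂ (ne , e′) =
    unpOnce {k = k} (ne ∘ cong (_, c)) (sym q) (subst (λ t → entry T (r₂ , c) ≡ just t) q e′)
  ... | inj₂ (ne , e′) | inj₁ (refl , q) =
    unpOnce {k = k} (ne ∘ cong (_, c)) (sym q) (subst (λ t → entry T (r₁ , c) ≡ just t) q e′)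
  ... | inj₂ (_ , e′) | inj₂ (_ , e″) = colUnp r₁ r₂ c₁ k lt e′ e″

tableau-transfer : ∀ T1 T2 → (∀ p → entry T1 p ≡ entry T2 p) → ShapeOK (rows T2) →
  IsPrimedTableau T1 → IsPrimedTableau T2
tableau-transfer T1 T2 E sh PT = record
  { shape     = sh
  ; entriesOK = λ p v e → entriesOK p v (trans (E p) e)
  ; rowWeak   = λ r c u v e1 e2 → rowWeak r c u v (trans (E _) e1) (trans (E _) e2)
  ; colWeak   = λ r c u v e1 e2 → colWeak r c u v (trans (E _) e1) (trans (E _) e2)
  ; rowPrime  = λ r c₁ c₂ i lt e1 e2 → rowPrime r c₁ c₂ i lt (trans (E _) e1) (trans (E _) e2)
  ; colUnp    = λ r₁ r₂ c i lt e1 e2 → colUnp r₁ r₂ c i lt (trans (E _) e1) (trans (E _) e2)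
  }
  where open IsPrimedTableau PT

set-commute : ∀ T r c r′ c′ v v′ {w w′} → entry T (r , c) ≡ just w → entry T (r′ , c′) ≡ just w′ →
  (r′ , c′) ≢ (r , c) → ∀ p →
  entry (setEntry (r , c) v (setEntry (r′ , c′) v′ T)) p ≡ entry (setEntry (r′ , c′) v′ (setEntry (r , c) v T)) p
set-commute T r c r′ c′ v v′ h h′ ne =
  commute (trans (set-other T r′ c′ v′ h′ (r , c) (ne ∘ sym)) h) (trans (set-other T r c v h (r′ , c′) ne) h′)
  where
  T′ T″ : Tableau
  T′ = setEntry (r′ , c′) v′ T
  T″ = setEntry (r , c) v T

  commute : ∀ {w w′} → entry (setEntry (r′ , c′) v′ T) (r , c) ≡ just w → entry (setEntry (r , c) v T) (r′ , c′) ≡ just w′ →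
    ∀ p → entry (setEntry (r , c) v (setEntry (r′ , c′) v′ T)) p ≡ entry (setEntry (r′ , c′) v′ (setEntry (r , c) v T)) p
  commute hA hB p with p ≟ₚ (r , c) | p ≟ₚ (r′ , c′)
  ... | yes refl | _ = trans (set-same T′ r c v hA) (sym (trans (set-other T″ r′ c′ v′ hB p (ne ∘ sym)) (set-same T r c v h)))
  ... | no n1 | yes refl = trans (trans (set-other T′ r c v hA p n1) (set-same T r′ c′ v′ h′)) (sym (set-same T″ r′ c′ v′ hB))
  ... | no n1 | no n2 = trans (trans (set-other T′ r c v hA p n1) (set-other T r′ c′ v′ h′ p n2))
                              (sym (trans (set-other T″ r′ c′ v′ hB p n2) (set-other T r c v h p n1)))


module Raise (T : Tableau) (PT : IsPrimedTableau T) where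
  open IsPrimedTableau PT
  open TableauFacts T PT

  rowWeak-at : ∀ {s b b′ u w} → suc b′ ≡ b → entry T (s , b′) ≡ just w → entry T (s , b) ≡ just u → w ≤ u
  rowWeak-at refl h hu = rowWeak _ _ _ _ h hu

  colWeak-at : ∀ {s s′ b u w} → suc s′ ≡ s → entry T (s′ , b) ≡ just w → entry T (s , b) ≡ just u → w ≤ u
  colWeak-at refl h hu = colWeak _ _ _ _ h hu

  row-once : ∀ {s b c′ u v} → entry T (s , b) ≡ just u → u < v →
    (∀ {z} → entry T (s , suc b) ≡ just z → v < z) → c′ ≢ b → entry T (s , c′) ≡ just v → ⊥
  row-once hu u<v east ne h with ≢⇒<⊎> ne
  ... | inj₁ lt = <⇒≱ u<v (rowMono (<⇒≤ lt) h hu)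
  ... | inj₂ lt = let (z , hz) = box-row hu h (n≤1+n _) lt in <⇒≱ (east hz) (rowMono lt hz h)

  column-once : ∀ {s b r′ u v} → entry T (s , b) ≡ just u → u < v →
    (∀ {z} → entry T (suc s , b) ≡ just z → v < z) → r′ ≢ s → entry T (r′ , b) ≡ just v → ⊥
  column-once hu u<v south ne h with ≢⇒<⊎> ne
  ... | inj₁ lt = <⇒≱ u<v (colMono (<⇒≤ lt) h hu)
  ... | inj₂ lt = let (z , hz) = box-below hu h lt in <⇒≱ (south hz) (colMono lt hz h)

  raise-to-unp : ∀ {s b u m} → entry T (s , b) ≡ just u → u < suc (suc (unp m)) →
    (∀ {z} → entry T (s , suc b) ≡ just z → suc (suc (unp m)) ≤ z) →
    (∀ {z} → entry T (suc s , b) ≡ just z → suc (suc (unp m)) < z) → Fits T s b (suc (suc (unp m)))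
  raise-to-unp {m = m} hu lt east south = record
    { positive  = s≤s z≤n
    ; fromWest  = λ eq h → ≤-trans (rowWeak-at eq h hu) (<⇒≤ lt)
    ; toEast    = east
    ; fromNorth = λ eq h → ≤-trans (colWeak-at eq h hu) (<⇒≤ lt)
    ; toSouth   = <⇒≤ ∘ south
    ; primeOnce = λ {_} {k} _ q _ → even≢prim m k q
    ; unpOnce   = λ ne _ h → column-once hu lt south ne h
    }

  raise-to-prim : ∀ {s b u m} → entry T (s , b) ≡ just u → u < suc (unp m) →
    (∀ {z} → entry T (s , suc b) ≡ just z → suc (unp m) < z) →
    (∀ {z} → entry T (suc s , b) ≡ just z → suc (unp m) ≤ z) → Fits T s b (suc (unp m))
  raise-to-prim {m = m} hu lt east south = record
    { positive  = s≤s z≤n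
    ; fromWest  = λ eq h → ≤-trans (rowWeak-at eq h hu) (<⇒≤ lt)
    ; toEast    = <⇒≤ ∘ east
    ; fromNorth = λ eq h → ≤-trans (colWeak-at eq h hu) (<⇒≤ lt)
    ; toSouth   = south
    ; primeOnce = λ ne _ h → row-once hu lt east ne h
    ; unpOnce   = λ {_} {k} _ q _ → odd≢unp m k q
    }

InJ : ℕ → ℕ → Set
InJ i e = e ≡ suc (unp i) ⊎ e ≡ suc (suc (unp i))

inJ-unfold : ∀ i T p → inJ (suc i) T p ≡ (eqE (entry T p) (suc (unp i)) ∨ eqE (entry T p) (suc (suc (unp i))))
inJ-unfold i T p = cong₂ (λ m n → eqE (entry T p) m ∨ eqE (entry T p) n) (prim-suc i) (unp-suc i)

inJ-yes : ∀ i T p {e} → entry T p ≡ just e → InJ i e → inJ (suc i) T p ≡ true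
inJ-yes i T p h (inj₁ q) rewrite inJ-unfold i T p | h | ≡ᵇ-true q = refl
inJ-yes i T p {e} h (inj₂ q) rewrite inJ-unfold i T p | h | ≡ᵇ-true q = ∨-zeroʳ (e ≡ᵇ suc (unp i))

inJ-true : ∀ i T p → inJ (suc i) T p ≡ true → Σ ℕ λ e → entry T p ≡ just e × InJ i e
inJ-true i T p h = from-test (entry T p) (trans (sym (inJ-unfold i T p)) h)
  where
  from-test : ∀ m → (eqE m (suc (unp i)) ∨ eqE m (suc (suc (unp i)))) ≡ true → Σ ℕ λ e → m ≡ just e × InJ i e
  from-test (just e) h with e ≟ suc (unp i) | e ≟ suc (suc (unp i))
  ... | yes q | _ = e , refl , inj₁ q
  ... | no _ | yes q = e , refl , inj₂ q
  ... | no n1 | no n2 rewrite ≡ᵇ-false n1 | ≡ᵇ-false n2 = case h of λ ()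

inJ-false : ∀ i T p {e} → inJ (suc i) T p ≡ false → entry T p ≡ just e → ¬ InJ i e
inJ-false i T p h ep q = case trans (sym h) (inJ-yes i T p ep q) of λ ()

geqE-true : ∀ m n → (∀ e → m ≡ just e → n ≤ e) → geqE m n ≡ true
geqE-true nothing n h = refl
geqE-true (just e) n h = T⇒true (≤⇒≤ᵇ (h e refl))

gtE-true : ∀ m n → (∀ e → m ≡ just e → n < e) → gtE m n ≡ true
gtE-true nothing n h = refl
gtE-true (just e) n h = T⇒true (<⇒<ᵇ (h e refl))

gtE-false : ∀ e n → e ≤ n → gtE (just e) n ≡ false
gtE-false e n h = ¬T⇒false (λ t → <⇒≱ (<ᵇ⇒< n e t) h)

eqE-false : ∀ m n → (∀ e → m ≡ just e → e ≢ n) → eqE m n ≡ false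
eqE-false nothing n h = refl
eqE-false (just e) n h = ≡ᵇ-false (h e refl)

chooseQ-F1 : ∀ i T r c →
  (geqE (entry T (r , suc c)) (unp (suc i)) ∧ gtE (entry T (suc r , c)) (unp (suc i))) ≡ true →
  chooseQ i T (r , c) ≡ just (r , c)
chooseQ-F1 i T r c h rewrite h = refl

chooseQ-F2 : ∀ i T r c →
  (geqE (entry T (r , suc c)) (unp (suc i)) ∧ gtE (entry T (suc r , c)) (unp (suc i))) ≡ false →
  eqE (entry T (r , suc c)) (prim (suc i)) ≡ true → chooseQ i T (r , c) ≡ just (r , suc c)
chooseQ-F2 i T r c h1 h2 rewrite h1 | h2 = refl

chooseQ-F3 : ∀ i T r c →
  (geqE (entry T (r , suc c)) (unp (suc i)) ∧ gtE (entry T (suc r , c)) (unp (suc i))) ≡ false →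
  eqE (entry T (r , suc c)) (prim (suc i)) ≡ false →
  (geqE (entry T (r , suc c)) (unp (suc i)) ∧
    (eqE (entry T (suc r , c)) (prim (suc i)) ∨ eqE (entry T (suc r , c)) (unp (suc i)))) ≡ true →
  chooseQ i T (r , c) ≡ just (walk (length (rows T) + c) (suc i) T (suc r , c))
chooseQ-F3 i T r c h1 h2 h3 rewrite h1 | h2 | h3 = refl

f-unfold : ∀ i T x q → rightmostUnbracketed i T ≡ just x → chooseQ i T x ≡ just q →
  f i T ≡ just (halfUp q (halfUp x T))
f-unfold i T x q h1 h2 rewrite h1 | h2 = refl

module Rightmost (i : ℕ) (T : Tableau) (PT : IsPrimedTableau T) (r c : ℕ)
                 (hx : rightmostUnbracketed i T ≡ just (r , c)) where
  open IsPrimedTableau PT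
  open TableauFacts T PT
  open SplitAt (rightmost-split i T (r , c) hx)
    renaming (before to u; after to v; word-split to hW; closed to hrun)

  ci cj′ cj : ℕ
  ci = unp i
  cj′ = suc ci
  cj = suc cj′

  x : Pos
  x = (r , c)

  sW : Sorted (u ++ (x , ci) ∷ v)
  sW = subst Sorted hW (W-sorted T)

  ex : entry T x ≡ just ci
  ex = All.head (++⁻ʳ u (subst (All (Good T)) hW (W-sound T)))

  cj-code : unp (suc i) ≡ cj
  cj-code = unp-suc i

  cj′-code : prim (suc i) ≡ cj′
  cj′-code = prim-suc i

  ind-cj : ind (cj ≟ cj) ≡ 1
  ind-cj = ind-yes (cj ≟ cj) refl

  ind-cj′ : ind (cj′ ≟ cj) ≡ 0
  ind-cj′ = ind-no (cj′ ≟ cj) (λ q → <-irrefl q (n<1+n cj′))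

  InJ-≤ : ∀ {e} → InJ i e → e ≤ cj
  InJ-≤ (inj₁ refl) = n≤1+n cj′
  InJ-≤ (inj₂ refl) = ≤-refl

  InJ-≥ : ∀ {e} → InJ i e → cj′ ≤ e
  InJ-≥ (inj₁ refl) = ≤-refl
  InJ-≥ (inj₂ refl) = n≤1+n cj′

  between-j′-j : ∀ {w} → cj′ ≤ w → w ≤ cj → InJ i w
  between-j′-j h1 h2 with m≤n⇒m<n∨m≡n h1
  ... | inj₂ q = inj₁ (sym q)
  ... | inj₁ q = inj₂ (≤-antisym h2 q)

  two-j′-in-row : ∀ {s b1 b2} → b1 < b2 → entry T (s , b1) ≡ just cj′ → entry T (s , b2) ≡ just cj′ → ⊥
  two-j′-in-row {s} {b1} {b2} lt e1 e2 =
    rowPrime s b1 b2 (suc i) lt (subst (λ t → entry T (s , b1) ≡ just t) (sym cj′-code) e1)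
                                (subst (λ t → entry T (s , b2) ≡ just t) (sym cj′-code) e2)

  two-j-in-column : ∀ {s1 s2 b} → s1 < s2 → entry T (s1 , b) ≡ just cj → entry T (s2 , b) ≡ just cj → ⊥
  two-j-in-column {s1} {s2} {b} lt e1 e2 =
    colUnp s1 s2 b (suc i) lt (subst (λ t → entry T (s1 , b) ≡ just t) (sym cj-code) e1)
                              (subst (λ t → entry T (s2 , b) ≡ just t) (sym cj-code) e2)

  below-x : ∀ {w} → entry T (suc r , c) ≡ just w → cj′ ≤ w
  below-x h = ≤∧≢⇒< (colWeak r c ci _ ex h) (λ q → colUnp r (suc r) c i (n<1+n r) ex (subst (λ t → entry T _ ≡ just t) (sym q) h))

  Between : Pos → Pos → Set
  Between y p = ¬ (p ≺ y) × (p ≺ x)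

  Between? : ∀ y p → Dec (Between y p)
  Between? y p = ¬? (p ≺? y) ×-dec (p ≺? x)

  jWeight iWeight : Pos → Pos → ℕ → ℕ
  jWeight y p e = when (Between? y p) (ind (e ≟ cj))
  iWeight y p e = when (Between? y p) (ind (e ≟ ci))

  J I : Pos → ℕ
  J y = total (jWeight y) (W T)
  I y = total (iWeight y) (W T)

  RowWest : ℕ → ℕ → Pos → Set
  RowWest s b p = proj₁ p ≡ s × proj₂ p < b

  RowWest? : ∀ s b p → Dec (RowWest s b p)
  RowWest? s b p = (proj₁ p ≟ s) ×-dec (proj₂ p <? b)

  aWeight : ℕ → ℕ → Pos → ℕ → ℕ
  aWeight s b p e = when (RowWest? s b p) (ind (e ≟ ci))

  A : Pos → ℕ
  A y = total (aWeight (pred (proj₁ y)) (proj₂ y)) (W T)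

  count-entry : ∀ g {p e} → entry T p ≡ just e → g p e ≤ total g (W T)
  count-entry g h = total-∈ g (W T) (W-complete T h)

  -- Since x is unbracketed, at least as many i's as j's are read from y up to x.
  bracket : ∀ y → J y ≤ I y
  bracket y =
    let (u1 , u2 , eu , a1 , a2) = Sorted-split y u (Sorted-++ˡ {u} sW)
        (allU , allV) = Sorted-mid {u} sW
        rest = (x , ci) ∷ v
        decomp : W T ≡ u1 ++ u2 ++ rest
        decomp = trans hW (trans (cong (_++ rest) eu) (++-assoc u1 u2 rest))
        restAfter : All (λ z → ¬ (key z ≺ x)) rest
        restAfter = ≺-irrefl ∷ All.map (λ lt gt → ≺-asym lt gt) allV
        u2Between : All (λ z → Between y (key z)) u2
        u2Between = All.zipWith (λ (p , q) → p , q) (a2 , ++⁻ʳ u1 (subst (All (λ z → key z ≺ x)) eu allU))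
        balanced : occ cj u2 ≤ occ ci u2
        balanced = subst (λ t → occ t u2 ≤ occ ci u2) cj-code
                     (suffix-balanced i u1 u2 (trans (cong (pending i (suc i) 0) (sym eu)) hrun))
    in begin
      J y                                                   ≡⟨ cong (total (jWeight y)) decomp ⟩
      total (jWeight y) (u1 ++ u2 ++ rest)                  ≡⟨ total-++ (jWeight y) u1 _ ⟩
      total (jWeight y) u1 + total (jWeight y) (u2 ++ rest) ≡⟨ cong (total (jWeight y) u1 +_) (total-++ (jWeight y) u2 rest) ⟩
      total (jWeight y) u1 + (total (jWeight y) u2 + total (jWeight y) rest)
        ≤⟨ +-mono-≤ (total-vanish u1 a1 (λ {p} lt → when-no (Between? y p) _ (λ b → proj₁ b lt)))
                    (+-monoʳ-≤ (total (jWeight y) u2) (total-vanish rest restAfter (λ {p} nx → when-no (Between? y p) _ (nx ∘ proj₂)))) ⟩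
      0 + (total (jWeight y) u2 + 0)                        ≡⟨ +-identityʳ _ ⟩
      total (jWeight y) u2                                  ≤⟨ total-mono′ u2 (λ p e → when-≤ (Between? y p) _) ⟩
      occ cj u2                                             ≤⟨ balanced ⟩
      occ ci u2                                             ≤⟨ total-mono u2Between (λ {p} b → when-yes (Between? y p) _ b) ⟩
      total (iWeight y) u2                                  ≤⟨ total-middle (iWeight y) u1 u2 rest ⟩
      total (iWeight y) (u1 ++ u2 ++ rest)                  ≡⟨ cong (total (iWeight y)) (sym decomp) ⟩
      I y                                                   ∎
    where open ≤-Reasoning

  no-excess : ∀ k y → k + I y ≤ J y → k ≤ 0
  no-excess k y h = +-cancelʳ-≤ (I y) k 0 (≤-trans h (bracket y))

  I-at-x : I x ≤ 0
  I-at-x = total-vanish (W T) (W-sound T) (λ {p} _ → when-no (Between? x p) _ (λ (np , px) → np px))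

  J-self : ∀ y {e} → y ≺ x → entry T y ≡ just e → ind (e ≟ cj) ≤ J y
  J-self y yx h = ≤-trans (when-yes (Between? y y) _ (≺-irrefl , yx)) (count-entry (jWeight y) h)

  J-extend : ∀ y y′ {e′} → y′ ≺ y → y′ ≺ x → entry T y′ ≡ just e′ → J y + ind (e′ ≟ cj) ≤ J y′
  J-extend y y′ {e′} lt lx h =
    ≤-trans (+-monoʳ-≤ (J y) (≤-trans (when-yes (y′ ≟ₚ y′) _ refl) (count-entry (λ p e → when (p ≟ₚ y′) (ind (e ≟ cj))) h)))
      (total-merge (W T) (λ p e → when-disjoint (Between? y p) (p ≟ₚ y′) (Between? y′ p) _
          (λ (np , px) → (λ q → np (≺-trans q lt)) , px)
          (λ { refl → ≺-irrefl , lx })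
          (λ (np , _) → λ { refl → np lt })))

  I-west : ∀ s b {e′} → entry T (s , b) ≡ just e′ → e′ ≢ ci → I (s , b) ≤ I (s , suc b)
  I-west s b {e′} h ne =
    ≤-trans (total-split₂ (W T) (λ p e → when-cover₂ (Between? (s , b) p) (Between? (s , suc b) p) (p ≟ₚ (s , b)) _
                 (λ (np , px) → case p ≺? (s , suc b) of λ where
                     (yes q) → inj₂ (≺-west-neighbour q np)
                     (no q) → inj₁ (q , px))))
      (≤-trans (+-monoʳ-≤ (I (s , suc b)) (total-vanish (W T) (W-sound T) (λ {p} {e} g →
                 when-vanish (p ≟ₚ (s , b)) _ (λ { refl → ≤-reflexive (ind-no (e ≟ ci) (λ q → ne (trans (just-injective (trans (sym h) g)) q))) }))))
       (≤-reflexive (+-identityʳ _)))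

  I-south : ∀ s b {e″} → entry T (suc s , b) ≡ just e″ → ci < e″ → I (suc s , b) ≤ I (s , b) + A (suc s , b)
  I-south s b {e″} h lt =
    ≤-trans (total-split₃ (W T) (λ p e → when-cover₃ (Between? (suc s , b) p) (Between? (s , b) p) (RowWest? s b p) (RowEast? p) _ (cover p)))
      (≤-reflexive (trans (cong (I (s , b) + A (suc s , b) +_) east-empty) (+-identityʳ _)))
    where
    RowEast : Pos → Set
    RowEast p = proj₁ p ≡ suc s × b ≤ proj₂ p
    RowEast? : ∀ p → Dec (RowEast p)
    RowEast? p = (proj₁ p ≟ suc s) ×-dec (b ≤? proj₂ p)
    cover : ∀ p → Between (suc s , b) p → Between (s , b) p ⊎ RowWest s b p ⊎ RowEast p
    cover (s′ , b′) (np , px) with (s′ , b′) ≺? (s , b)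
    ... | no q = inj₁ (q , px)
    ... | yes (inj₂ (refl , l)) = inj₂ (inj₁ (refl , l))
    ... | yes (inj₁ l) with s′ ≟ suc s
    ... | no ne = ⊥-elim (np (inj₁ (≤∧≢⇒< l (ne ∘ sym))))
    ... | yes refl = inj₂ (inj₂ (refl , ≮⇒≥ (λ l2 → np (inj₂ (refl , l2)))))
    -- row s + 1 has no i from column b on, since its entry at b exceeds i
    east-empty : total (λ p e → when (RowEast? p) (ind (e ≟ ci))) (W T) ≡ 0
    east-empty = n≤0⇒n≡0 (total-vanish (W T) (W-sound T) (λ {p} {e} g → no-i p e g))
      where
      no-i : ∀ p e → entry T p ≡ just e → when (RowEast? p) (ind (e ≟ ci)) ≤ 0
      no-i (s′ , b′) e g = when-vanish (RowEast? (s′ , b′)) _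
        (λ { (refl , bb) → ≤-reflexive (ind-no (e ≟ ci) (λ { refl → <⇒≱ lt (rowMono bb h g) })) })

  -- The row above y contains a box West of y only once.
  A-west : ∀ s b → A (s , suc b) ≤ A (s , b) + 1
  A-west s b =
    ≤-trans (total-split₂ (W T) (λ p e → when-cover₂ (RowWest? s′ (suc b) p) (RowWest? s′ b p) (p ≟ₚ (s′ , b)) _ (cover p)))
      (+-monoʳ-≤ (A (s , b)) (≤-trans (total-mono′ (W T) (λ p e → at-most-1 (p ≟ₚ (s′ , b)) (e ≟ ci)))
        (Sorted-unique (s′ , b) (W T) (W-sorted T))))
    where
    s′ = pred s
    cover : ∀ p → RowWest s′ (suc b) p → RowWest s′ b p ⊎ p ≡ (s′ , b)
    cover (p1 , p2) (refl , l) with p2 <? b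
    ... | yes l2 = inj₁ (refl , l2)
    ... | no l2 = inj₂ (cong (p1 ,_) (≤-antisym (≤-pred l) (≮⇒≥ l2)))
    at-most-1 : ∀ {P Q : Set} (P? : Dec P) (Q? : Dec Q) → when P? (ind Q?) ≤ when P? 1
    at-most-1 (yes _) Q? = when-≤ Q? 1
    at-most-1 (no _) _ = z≤n

  -- An i in row s West of (suc s , b) lies above some box of row s + 1,
  -- so row s + 1 has a box West of b holding a letter ≥ j'.
  A-witness : ∀ s b {ey} → entry T (suc s , b) ≡ just ey → 0 < A (suc s , b) →
    Σ ℕ λ b′ → b ≡ suc b′ × Σ ℕ λ w → entry T (suc s , b′) ≡ just w × cj′ ≤ w × w ≤ ey
  A-witness s b {ey} hy pos with total-pos (aWeight s b) (W T) pos
  ... | some with Any.lookup some | All.lookupAny (W-sound T) some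
  ... | ((s′ , col) , e) | g , pz with when-pos (RowWest? s b (s′ , col)) _ pz
  ... | (refl , cl) , pz2 with when-pos (e ≟ ci) 1 pz2
  ... | refl , _ =
    let (w0 , e0) = box-down g hy (<⇒≤ cl)
        w0≢ci : w0 ≢ ci
        w0≢ci q = colUnp s (suc s) col i (n<1+n s) g (subst (λ t → entry T (suc s , col) ≡ just t) q e0)
    in west-of b cl (≤∧≢⇒< (colWeak s col ci w0 g e0) (w0≢ci ∘ sym)) e0 hy
    where
    west-of : ∀ b → col < b → ∀ {w0} → cj′ ≤ w0 → entry T (suc s , col) ≡ just w0 → entry T (suc s , b) ≡ just ey →
      Σ ℕ λ b′ → b ≡ suc b′ × Σ ℕ λ w → entry T (suc s , b′) ≡ just w × cj′ ≤ w × w ≤ ey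
    west-of (suc b′) cl jw e0 hy =
      let (w , ew) = box-row e0 hy (≤-pred cl) (n≤1+n b′)
      in b′ , refl , w , ew , ≤-trans jw (rowMono (≤-pred cl) e0 ew) , rowMono (n≤1+n b′) ew hy

  Excess : ℕ → Pos → ℕ → Set
  Excess k y ey = k + ind (ey ≟ cj) + I y ≤ J y + A y

  ind-at-j : ∀ {e} → e ≡ cj → ind (e ≟ cj) ≡ 1
  ind-at-j refl = ind-cj

  regroup : ∀ k n m → k + n + m ≡ n + (k + m)
  regroup k n m = trans (cong (_+ m) (+-comm k n)) (+-assoc n k m)

  excess-bound : ∀ k y {ey} → Excess k y ey → A y ≤ 0 → k + ind (ey ≟ cj) ≤ 0
  excess-bound k y {ey} inv a0 =
    no-excess (k + ind (ey ≟ cj)) y (≤-trans inv (≤-trans (+-monoʳ-≤ (J y) a0) (≤-reflexive (+-identityʳ _))))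

  A-zero : ∀ s b {ey} → entry T (suc s , b) ≡ just ey → InJ i ey →
    (∀ {b′ w} → b ≡ suc b′ → entry T (suc s , b′) ≡ just w → ¬ InJ i w) → A (suc s , b) ≤ 0
  A-zero s b hy eyJ blocked = ≮⇒≥ λ pos →
    let (b′ , eb , w , ew , jw , wy) = A-witness s b hy pos
    in blocked eb ew (between-j′-j jw (≤-trans wy (InJ-≤ eyJ)))

  -- A ribbon box with a ribbon box below holds j' (no two j's in a column).
  south-in-ribbon : ∀ {s b ey e″} → entry T (s , b) ≡ just ey → InJ i ey →
    entry T (suc s , b) ≡ just e″ → InJ i e″ → ey ≡ cj′
  south-in-ribbon hy (inj₁ q) h″ _ = q
  south-in-ribbon hy (inj₂ refl) h″ (inj₂ refl) = ⊥-elim (two-j-in-column (n<1+n _) hy h″)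
  south-in-ribbon {s} {b} hy (inj₂ refl) h″ (inj₁ refl) = ⊥-elim (<⇒≱ (n<1+n cj′) (colWeak s b cj cj′ hy h″))

  -- A ribbon box with a ribbon box West of it holds j (no two j' in a row).
  west-in-ribbon : ∀ {s b ey e′} → entry T (s , suc b) ≡ just ey → InJ i ey →
    entry T (s , b) ≡ just e′ → InJ i e′ → ey ≡ cj
  west-in-ribbon hy (inj₂ q) h′ _ = q
  west-in-ribbon {s} {b} hy (inj₁ refl) h′ e′J = ⊥-elim (
    two-j′-in-row (n<1+n b) (subst (λ t → entry T (s , b) ≡ just t) (≤-antisym (rowWeak s b _ cj′ h′ hy) (InJ-≥ e′J)) h′) hy)

  excess-south : ∀ k s b {ey e″} → r < suc s → entry T (suc s , b) ≡ just ey → InJ i ey →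
    entry T (suc (suc s) , b) ≡ just e″ → InJ i e″ → Excess k (suc s , b) ey → Excess k (suc (suc s) , b) e″
  excess-south k s b {ey} {e″} rs hy eyJ h″ e″J inv = begin
      k + n″ + I y″            ≤⟨ +-monoʳ-≤ (k + n″) (I-south (suc s) b h″ (≤-trans (n<1+n ci) (InJ-≥ e″J))) ⟩
      k + n″ + (I y + A y″)    ≡⟨ trans (sym (+-assoc (k + n″) (I y) (A y″))) (cong (_+ A y″) (regroup k n″ (I y))) ⟩
      n″ + (k + I y) + A y″    ≤⟨ +-monoˡ-≤ (A y″) (+-monoʳ-≤ n″ paid) ⟩
      n″ + J y + A y″          ≡⟨ cong (_+ A y″) (+-comm n″ (J y)) ⟩
      J y + n″ + A y″          ≤⟨ +-monoˡ-≤ (A y″) (J-extend y y″ (inj₁ (n<1+n (suc s))) (inj₁ (<-trans rs (n<1+n (suc s)))) h″) ⟩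
      J y″ + A y″              ∎
    where
    open ≤-Reasoning
    y y″ : Pos
    y = (suc s , b)
    y″ = (suc (suc s) , b)
    n″ = ind (e″ ≟ cj)
    ey≡j′ = south-in-ribbon hy eyJ h″ e″J
    -- West of y in its row there is no second j'
    A-y : A y ≤ 0
    A-y = ≮⇒≥ λ pos →
      let (b′ , eb , w , ew , jw , wy) = A-witness s b hy pos
          w≡j′ = ≤-antisym (≤-trans wy (≤-reflexive ey≡j′)) jw
      in two-j′-in-row (subst (b′ <_) (sym eb) (n<1+n b′))
           (subst (λ t → entry T (suc s , b′) ≡ just t) w≡j′ ew) (subst (λ t → entry T (suc s , b) ≡ just t) ey≡j′ hy)
    paid : k + I y ≤ J y
    paid = ≤-trans (≤-reflexive (cong (_+ I y) (sym (trans (cong (k +_) (trans (cong (λ t → ind (t ≟ cj)) ey≡j′) ind-cj′)) (+-identityʳ k)))))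
             (≤-trans inv (≤-trans (+-monoʳ-≤ (J y) A-y) (≤-reflexive (+-identityʳ _))))

  excess-west : ∀ k s b {ey e′} → r < s → entry T (s , suc b) ≡ just ey → InJ i ey →
    entry T (s , b) ≡ just e′ → InJ i e′ → Excess k (s , suc b) ey → Excess k (s , b) e′
  excess-west k s b {ey} {e′} rs hy eyJ h′ e′J inv = begin
      k + n′ + I y′            ≤⟨ +-monoʳ-≤ (k + n′) (I-west s b h′ e′≢ci) ⟩
      k + n′ + I y             ≡⟨ regroup k n′ (I y) ⟩
      n′ + (k + I y)           ≤⟨ +-monoʳ-≤ n′ paid ⟩
      n′ + (J y + A y′)        ≡⟨ sym (+-assoc n′ (J y) (A y′)) ⟩
      n′ + J y + A y′          ≡⟨ cong (_+ A y′) (+-comm n′ (J y)) ⟩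
      J y + n′ + A y′          ≤⟨ +-monoˡ-≤ (A y′) (J-extend y y′ (inj₂ (refl , n<1+n b)) (inj₁ rs) h′) ⟩
      J y′ + A y′              ∎
    where
    open ≤-Reasoning
    y y′ : Pos
    y = (s , suc b)
    y′ = (s , b)
    n′ = ind (e′ ≟ cj)
    e′≢ci : e′ ≢ ci
    e′≢ci q = <-irrefl (sym q) (≤-trans (n<1+n ci) (InJ-≥ e′J))
    -- the j at y is paid for by one i fewer West of y′ than West of y
    paid : k + I y ≤ J y + A y′
    paid = ≤-pred (begin
      suc (k + I y)            ≡⟨ cong (_+ I y) (+-comm 1 k) ⟩
      k + 1 + I y              ≡⟨ cong (λ t → k + t + I y) (sym (ind-at-j (west-in-ribbon hy eyJ h′ e′J))) ⟩
      k + ind (ey ≟ cj) + I y  ≤⟨ inv ⟩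
      J y + A y                ≤⟨ +-monoʳ-≤ (J y) (A-west s b) ⟩
      J y + (A y′ + 1)         ≡⟨ trans (cong (J y +_) (+-comm (A y′) 1)) (+-suc (J y) (A y′)) ⟩
      suc (J y + A y′)         ∎)

  -- An excess of one can never be paid for: walking West, A vanishes.
  no-strict-excess : ∀ s b {ey} → r < suc s → entry T (suc s , b) ≡ just ey → InJ i ey →
    Excess 1 (suc s , b) ey → ⊥
  no-strict-excess s b {ey} rs hy eyJ inv with 0 <? A (suc s , b)
  ... | no np = case excess-bound 1 (suc s , b) {ey} inv (≮⇒≥ np) of λ ()
  ... | yes pos with A-witness s b hy pos
  ... | b′ , refl , w , ew , jw , wy =
    no-strict-excess s b′ rs ew wJ (excess-west 1 (suc s) b′ rs hy eyJ ew wJ inv)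
    where wJ = between-j′-j jw (≤-trans wy (InJ-≤ eyJ))

  RibbonEnd : Pos → Set
  RibbonEnd q = entry T q ≡ just cj′ × inJ (suc i) T (suc (proj₁ q) , proj₂ q) ≡ false × r < proj₁ q

  ribbon-end : ∀ s b {ey} → r < suc s → entry T (suc s , b) ≡ just ey → InJ i ey →
    inJ (suc i) T (suc (suc s) , b) ≡ false → Excess 0 (suc s , b) ey → A (suc s , b) ≤ 0 → RibbonEnd (suc s , b)
  ribbon-end s b {ey} rs hy eyJ eS inv a0 = subst (λ t → entry T (suc s , b) ≡ just t) ey≡j′ hy , eS , rs
    where
    ey≡j′ = [ id , (λ q → case ≤-trans (≤-reflexive (sym (ind-at-j q))) (excess-bound 0 (suc s , b) {ey} inv a0) of λ ()) ]′ eyJ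

  -- The walk along the ribbon keeps the invariant, hence stops at a j'.
  -- (The fuel bounds the remaining South plus West steps.)
  walk-ends : ∀ f s b {ey} → r < suc s → entry T (suc s , b) ≡ just ey → InJ i ey →
    length (rows T) ∸ suc s + b ≤ f → Excess 0 (suc s , b) ey → RibbonEnd (walk f (suc i) T (suc s , b))
  walk-ends zero s b rs hy eyJ fuel inv =
    ⊥-elim (m>n⇒m∸n≢0 (entry-row< {T} hy) (n≤0⇒n≡0 (≤-trans (m≤m+n _ b) fuel)))
  walk-ends (suc f) s b rs hy eyJ fuel inv with inJ (suc i) T (suc (suc s) , b) in eS
  ... | true =
    let (e″ , h″ , e″J) = inJ-true i T _ eS
        fuel″ = ≤-pred (subst (_≤ suc f) (cong (_+ b) (+-∸-assoc 1 (entry-row< {T} hy))) fuel)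
    in walk-ends f (suc s) b (<-trans rs (n<1+n (suc s))) h″ e″J fuel″ (excess-south 0 s b rs hy eyJ h″ e″J inv)
  walk-ends (suc f) s zero rs hy eyJ fuel inv | false =
    ribbon-end s 0 rs hy eyJ eS inv (A-zero s 0 hy eyJ (λ ()))
  walk-ends (suc f) s (suc b) rs hy eyJ fuel inv | false with inJ (suc i) T (suc s , b) in eW
  ... | false = ribbon-end s (suc b) rs hy eyJ eS inv (A-zero s (suc b) hy eyJ (λ { refl → inJ-false i T _ eW }))
  ... | true =
    let (e′ , h′ , e′J) = inJ-true i T _ eW
    in walk-ends f s b rs h′ e′J (≤-pred (subst (_≤ suc f) (+-suc _ b) fuel)) (excess-west 0 (suc s) b rs hy eyJ h′ e′J inv)

  E S : Pos
  E = (r , suc c)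
  S = (suc r , c)

  I-below-x : ∀ {eS} → entry T S ≡ just eS → I S ≤ A S
  I-below-x hS = ≤-trans (I-south r c hS (below-x hS)) (+-monoˡ-≤ (A S) I-at-x)

  -- The box East of x does not hold an i: it would be read right after x,
  -- hence open the word v and be unbracketed.
  east-not-i : entry T E ≡ just ci → ⊥
  east-not-i hE with ∈-++⁻ u (subst ((E , ci) ∈_) hW (W-complete T hE))
  ... | inj₁ m = ≺-asym (All.lookup (proj₁ (Sorted-mid {u} sW)) m) (inj₂ (refl , n<1+n c))
  ... | inj₂ (here q) = <-irrefl (sym (cong (proj₂ ∘ proj₁) q)) (n<1+n c)
  ... | inj₂ (there m) =
    let (v′ , ev) = adjacent-head v (Sorted-++ʳ {u} sW) m ≺-no-between
    in case trans (sym (unbracketed-first-i i E v′)) (trans (cong (unbracketedI i (suc i) 0) (sym ev)) after-bracketed) of λ ()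

  -- The box Southeast of x does not hold a j: the j there, read before x,
  -- would leave an excess of one at S.
  southeast-not-j : entry T (suc r , suc c) ≡ just cj → ⊥
  southeast-not-j hD =
    let (eS , hS) = box-down ex hD (n≤1+n c)
        eSJ = between-j′-j (below-x hS) (rowWeak (suc r) c eS cj hS hD)
        D = (suc r , suc c)
        JD : 1 ≤ J D
        JD = ≤-trans (≤-reflexive (sym ind-cj)) (J-self D (inj₁ (n<1+n r)) hD)
        inv : Excess 1 S eS
        inv = begin
          1 + ind (eS ≟ cj) + I S   ≤⟨ +-monoʳ-≤ (1 + ind (eS ≟ cj)) (I-below-x hS) ⟩
          1 + ind (eS ≟ cj) + A S   ≤⟨ +-monoˡ-≤ (A S) (+-monoˡ-≤ (ind (eS ≟ cj)) JD) ⟩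
          J D + ind (eS ≟ cj) + A S ≤⟨ +-monoˡ-≤ (A S) (J-extend D S (inj₂ (refl , n<1+n c)) (inj₁ (n<1+n r)) hS) ⟩
          J S + A S                 ∎
    in no-strict-excess r c (n<1+n r) hS eSJ inv
    where open ≤-Reasoning

  F3-walk-ends : ∀ {eS} → entry T S ≡ just eS → InJ i eS → RibbonEnd (walk (length (rows T) + c) (suc i) T S)
  F3-walk-ends hS eSJ = walk-ends (length (rows T) + c) r c (n<1+n r) hS eSJ
    (+-monoˡ-≤ c (m∸n≤m _ (suc r)))
    (+-mono-≤ (J-self S (inj₁ (n<1+n r)) hS) (I-below-x hS))

  -- c(E) ≥ j and c(S) > j, where c = ∞ outside T
  EastAtLeastJ SouthAboveJ : Set
  EastAtLeastJ = ∀ e → entry T E ≡ just e → cj ≤ e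
  SouthAboveJ = ∀ e → entry T S ≡ just e → cj < e

  E≢x : E ≢ x
  E≢x q = <-irrefl (sym (cong proj₂ q)) (n<1+n c)

  -- c(E) is j' or at least j, because it is not i.
  east-cases : entry T E ≡ just cj′ ⊎ EastAtLeastJ
  east-cases with entry T E in eq
  ... | nothing = inj₂ (λ e ())
  ... | just e with e ≟ cj′
  ... | yes q = inj₁ (cong just q)
  ... | no e≢j′ = inj₂ (λ e′ h → subst (cj ≤_) (just-injective h) (≤∧≢⇒< (≤∧≢⇒< (rowWeak r c ci e ex eq) e≢i) (e≢j′ ∘ sym)))
    where
    e≢i : ci ≢ e
    e≢i q = east-not-i (trans eq (cong just (sym q)))

  -- c(S) is more than j, or one of j', j (it is at least j').
  south-cases : SouthAboveJ ⊎ Σ ℕ λ eS → entry T S ≡ just eS × InJ i eS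
  south-cases with entry T S in eq
  ... | nothing = inj₁ (λ e ())
  ... | just e with e ≤? cj
  ... | yes le = inj₂ (e , refl , between-j′-j (below-x eq) le)
  ... | no nle = inj₁ (λ e′ h → subst (cj <_) (just-injective h) (≰⇒> nle))

  east-of-j′ : ∀ {s b z} → entry T (s , b) ≡ just cj′ → entry T (s , suc b) ≡ just z → cj ≤ z
  east-of-j′ {s} {b} hb hz =
    ≤∧≢⇒< (rowWeak s b cj′ _ hb hz) (λ q → two-j′-in-row (n<1+n b) hb (subst (λ t → entry T (s , suc b) ≡ just t) (sym q) hz))

  fits-F1 : EastAtLeastJ → SouthAboveJ → Fits T r c cj
  fits-F1 hE hS = raise-to-unp {m = i} ex (≤-trans (n<1+n ci) (n≤1+n cj′)) (hE _) (hS _)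
    where open Raise T PT

  -- In case F2 the entry Southeast of x exceeds j: it is at least c(E) = j',
  -- not j', as the entry South of x is at least j' and West of it, and not j.
  southeast-above-j : entry T E ≡ just cj′ → ∀ {w} → entry T (suc r , suc c) ≡ just w → cj < w
  southeast-above-j hE {w} h =
    let (eS , hS) = box-down ex h (n≤1+n c)
        w≢j′ : w ≢ cj′
        w≢j′ q = two-j′-in-row (n<1+n c)
          (subst (λ t → entry T S ≡ just t) (≤-antisym (≤-trans (rowWeak (suc r) c eS w hS h) (≤-reflexive q)) (below-x hS)) hS)
          (subst (λ t → entry T _ ≡ just t) q h)
        w≢j : w ≢ cj
        w≢j q = southeast-not-j (subst (λ t → entry T _ ≡ just t) q h)
    in ≤∧≢⇒< (≤∧≢⇒< (colWeak r (suc c) cj′ w hE h) (w≢j′ ∘ sym)) (w≢j ∘ sym)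

  -- In case F2, raising E to j and x to j' (in this order) keeps a primed
  -- tableau; the two changes commute.
  tableau-F2 : entry T E ≡ just cj′ → IsPrimedTableau (setEntry E cj (setEntry x cj′ T))
  tableau-F2 hE =
    tableau-transfer (setEntry x cj′ TE) _ (set-commute T r c r (suc c) cj′ cj ex hE E≢x)
      (modify-shape _ E _ (modify-shape _ x T shape))
      (set-preserves-tableau TE r c cj′ PTE exE (Raise.raise-to-prim TE PTE {m = i} exE (n<1+n ci) eastE southE))
    where
    TE = setEntry E cj T
    PTE = set-preserves-tableau T r (suc c) cj PT hE
            (Raise.raise-to-unp T PT {m = i} hE (n<1+n cj′) (east-of-j′ hE) (southeast-above-j hE))
    exE : entry TE x ≡ just ci
    exE = trans (set-other T r (suc c) cj hE x (E≢x ∘ sym)) ex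
    eastE : ∀ {z} → entry TE E ≡ just z → cj′ < z
    eastE h = ≤-reflexive (just-injective (trans (sym (set-same T r (suc c) cj hE)) h))
    southE : ∀ {z} → entry TE S ≡ just z → cj′ ≤ z
    southE h = below-x (trans (sym (set-other T r (suc c) cj hE S (λ q → <-irrefl (sym (cong proj₁ q)) (n<1+n r)))) h)

  tableau-F3 : EastAtLeastJ → ∀ qs qb → RibbonEnd (qs , qb) → IsPrimedTableau (setEntry (qs , qb) cj (setEntry x cj′ T))
  tableau-F3 hE qs qb (eQ , below-not-in-ribbon , r<qs) =
    set-preserves-tableau TX qs qb cj PTX eQX (Raise.raise-to-unp TX PTX {m = i} eQX (n<1+n cj′) eastQ southQ)
    where
    TX = setEntry x cj′ T
    PTX = set-preserves-tableau T r c cj′ PT ex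
            (Raise.raise-to-prim T PT {m = i} ex (n<1+n ci) (λ h → <-≤-trans (n<1+n cj′) (hE _ h)) below-x)
    TX-low : ∀ {s b} → r < s → entry TX (s , b) ≡ entry T (s , b)
    TX-low r<s = set-other T r c cj′ ex _ (λ q → <-irrefl (sym (cong proj₁ q)) r<s)
    eQX : entry TX (qs , qb) ≡ just cj′
    eQX = trans (TX-low r<qs) eQ
    eastQ : ∀ {z} → entry TX (qs , suc qb) ≡ just z → cj ≤ z
    eastQ h = east-of-j′ eQ (trans (sym (TX-low r<qs)) h)
    southQ : ∀ {z} → entry TX (suc qs , qb) ≡ just z → cj < z
    southQ {z} h =
      let h′ = trans (sym (TX-low (<-trans r<qs (n<1+n qs)))) h
          not-in = inJ-false i T (suc qs , qb) below-not-in-ribbon h′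
      in ≤∧≢⇒< (≤∧≢⇒< (colWeak qs qb cj′ z eQ h′) (not-in ∘ inj₁ ∘ sym)) (not-in ∘ inj₂ ∘ sym)

  Conclusion : Set
  Conclusion = Σ Pos (λ q → chooseQ i T x ≡ just q ×
    Σ Tableau (λ T′ → f i T ≡ just T′ ×
      ((q ≡ x × entry T x ≡ just (unp i) × T′ ≡ setEntry x (unp (suc i)) T)
       ⊎ (q ≢ x × entry T x ≡ just (unp i) × entry T q ≡ just (prim (suc i)) ×
          T′ ≡ setEntry q (unp (suc i)) (setEntry x (prim (suc i)) T)))
      × IsPrimedTableau T′))

  east-geq : EastAtLeastJ → geqE (entry T E) (unp (suc i)) ≡ true
  east-geq hE = geqE-true (entry T E) _ (λ e h → subst (_≤ e) (sym cj-code) (hE e h))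

  result-F1 : EastAtLeastJ → SouthAboveJ → Conclusion
  result-F1 hE hS = x , chosen , _ , f-unfold i T x x hx chosen , inj₁ (refl , ex , T′≡) ,
                    subst IsPrimedTableau (sym T′≡) tableau
    where
    chosen = chooseQ-F1 i T r c (cong₂ _∧_ (east-geq hE) (gtE-true (entry T S) _ (λ e h → subst (_< e) (sym cj-code) (hS e h))))
    T′≡ : halfUp x (halfUp x T) ≡ setEntry x (unp (suc i)) T
    T′≡ = trans (halfUp-twice T r c ex) (cong (λ t → setEntry x t T) (sym cj-code))
    tableau = subst (λ t → IsPrimedTableau (setEntry x t T)) (sym cj-code)
                (set-preserves-tableau T r c cj PT ex (fits-F1 hE hS))

  result-via : ∀ qs qb → chooseQ i T x ≡ just (qs , qb) → (qs , qb) ≢ x → entry T (qs , qb) ≡ just cj′ →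
    IsPrimedTableau (setEntry (qs , qb) cj (setEntry x cj′ T)) → Conclusion
  result-via qs qb chosen q≢x hq tableau =
    (qs , qb) , chosen , _ , f-unfold i T x (qs , qb) hx chosen ,
    inj₂ (q≢x , ex , subst (λ t → entry T (qs , qb) ≡ just t) (sym cj′-code) hq , T′≡) ,
    subst IsPrimedTableau (sym T′≡) (subst₂ (λ a b → IsPrimedTableau (setEntry (qs , qb) a (setEntry x b T))) (sym cj-code) (sym cj′-code) tableau)
    where
    hq′ : entry (setEntry x cj′ T) (qs , qb) ≡ just cj′
    hq′ = trans (set-other T r c cj′ ex (qs , qb) q≢x) hq
    T′≡ : halfUp (qs , qb) (halfUp x T) ≡ setEntry (qs , qb) (unp (suc i)) (setEntry x (prim (suc i)) T)
    T′≡ = begin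
      halfUp (qs , qb) (halfUp x T)                    ≡⟨ cong (halfUp (qs , qb)) (halfUp-set T r c ex) ⟩
      halfUp (qs , qb) (setEntry x cj′ T)              ≡⟨ halfUp-set (setEntry x cj′ T) qs qb hq′ ⟩
      setEntry (qs , qb) cj (setEntry x cj′ T)         ≡⟨ cong₂ (λ a b → setEntry (qs , qb) a (setEntry x b T)) (sym cj-code) (sym cj′-code) ⟩
      setEntry (qs , qb) (unp (suc i)) (setEntry x (prim (suc i)) T) ∎
      where open ≡-Reasoning

  result-F2 : entry T E ≡ just cj′ → Conclusion
  result-F2 hE = result-via r (suc c) chosen E≢x hE (tableau-F2 hE)
    where
    not-F1 = cong (_∧ gtE (entry T S) (unp (suc i)))
               (trans (cong (λ m → geqE m (unp (suc i))) hE) (≤ᵇ-false (subst (cj′ <_) (sym cj-code) (n<1+n cj′))))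
    chosen = chooseQ-F2 i T r c not-F1 (trans (cong (λ m → eqE m (prim (suc i))) hE) (≡ᵇ-true (sym cj′-code)))

  result-F3 : EastAtLeastJ → ∀ {eS} → entry T S ≡ just eS → InJ i eS → Conclusion
  result-F3 hE {eS} hS eSJ = result-via qs qb chosen q≢x (proj₁ end) (tableau-F3 hE qs qb end)
    where
    qs = proj₁ (walk (length (rows T) + c) (suc i) T S)
    qb = proj₂ (walk (length (rows T) + c) (suc i) T S)
    end = F3-walk-ends hS eSJ
    q≢x : (qs , qb) ≢ x
    q≢x q = <-irrefl (sym (cong proj₁ q)) (proj₂ (proj₂ end))
    not-F1 = cong₂ _∧_ (east-geq hE)
               (trans (cong (λ m → gtE m (unp (suc i))) hS) (gtE-false eS _ (subst (eS ≤_) (sym cj-code) (InJ-≤ eSJ))))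
    not-F2 = eqE-false (entry T E) _ (λ e h q → <⇒≱ (n<1+n cj′) (≤-trans (hE e h) (≤-reflexive (trans q cj′-code))))
    chosen = chooseQ-F3 i T r c not-F1 not-F2 (cong₂ _∧_ (east-geq hE) (inJ-yes i T S hS eSJ))

  conclusion : Conclusion
  conclusion with east-cases
  ... | inj₁ hE = result-F2 hE
  ... | inj₂ hE with south-cases
  ... | inj₁ hS = result-F1 hE hS
  ... | inj₂ (eS , hS , eSJ) = result-F3 hE hS eSJ

mainTheorem4 : (i : ℕ) (T : Tableau) → 1 ≤ i → IsPrimedTableau T →
    (x : Pos) → rightmostUnbracketed i T ≡ just x →
    Σ Pos (λ q → chooseQ i T x ≡ just q ×
      Σ Tableau (λ T′ → f i T ≡ just T′ ×
        ((q ≡ x × entry T x ≡ just (unp i) × T′ ≡ setEntry x (unp (suc i)) T)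
         ⊎ (q ≢ x × entry T x ≡ just (unp i) × entry T q ≡ just (prim (suc i)) ×
            T′ ≡ setEntry q (unp (suc i)) (setEntry x (prim (suc i)) T)))
        × IsPrimedTableau T′))
mainTheorem4 i T _ PT (r , c) hx = Rightmost.conclusion i T PT r c hx
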